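{- For $n \ge 3$, $Z(L(W_{1,n})) = n+1$, where $W_{1,n} = C_n + K_1$ is the wheel graph.
   Context: $W_{1,n} = C_n + K_1$ is the join of the cycle $C_n$ with one extra vertex adjacent to all vertices of $C_n$. $L(G)$ is the line graph of $G$ (vertex set $E(G)$, adjacency meaning sharing an endpoint). Zero forcing: each vertex of a graph $H$ is colored black or white; if a black vertex $u$ has exactly one white neighbor $w$, then $w$ becomes black (color-change rule). $S \subseteq V(H)$ is a zero forcing set if, starting with exactly $S$ black, repeated application of the rule makes every vertex black. $Z(H)$ is the minimum size of a zero forcing set of $H$. -}

module Defs where

open import Data.Bool using (Bool; true; false; _∧_; _∨_; not; T; T?)
open import Data.Nat using (ℕ; zero; suc; _∸_; _≡ᵇ_; _≤_)
open import Data.Fin using (Fin; zero; suc; toℕ)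
open import Data.Fin.Properties using (_<?_)
open import Data.Fin.Subset using (Subset; _∈_; ∣_∣)
open import Data.List using (List; []; _∷_; length; concatMap; filter; lookup)
open import Data.List using (allFin) renaming (map to lmap)
open import Data.Product using (Σ; _×_; _,_; proj₁; proj₂)
open import Relation.Nullary.Decidable using (⌊_⌋)
open import Relation.Binary.PropositionalEquality using (_≡_; _≢_)

-- A finite simple graph is given by its number of vertices N (vertex set Fin N)
-- and a Boolean adjacency function (symmetric, irreflexive for all graphs below).
Adj : ℕ → Set
Adj N = Fin N → Fin N → Bool

_=ᶠ_ : ∀ {m} → Fin m → Fin m → Bool
a =ᶠ b = toℕ a ≡ᵇ toℕ b

edges : (N : ℕ) → Adj N → List (Fin N × Fin N)
edges N adj = filter (λ p → T? (adj (proj₁ p) (proj₂ p)))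
            (concatMap (λ i → lmap (λ j → (i , j)) (filter (λ j → i <? j) (allFin N)))
                       (allFin N))

shareEnd : ∀ {m} → (Fin m × Fin m) → (Fin m × Fin m) → Bool
shareEnd (a , b) (c , d) =
  not ((a =ᶠ c) ∧ (b =ᶠ d)) ∧ ((a =ᶠ c) ∨ (a =ᶠ d) ∨ (b =ᶠ c) ∨ (b =ᶠ d))

-- Line graph L(G): vertex set = edges of G (indexed by Fin (number of edges)).
lineSize : (N : ℕ) → Adj N → ℕ
lineSize N adj = length (edges N adj)

lineAdj : (N : ℕ) (adj : Adj N) → Adj (lineSize N adj)
lineAdj N adj e f = shareEnd (lookup (edges N adj) e) (lookup (edges N adj) f)

-- Wheel W_{1,n} = C_n + K_1 on Fin (suc n): vertex 0 is the hub,
-- vertices suc a (a : Fin n) form the cycle 0 - 1 - ... - (n-1) - 0.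
cycAdj : (n : ℕ) → Fin n → Fin n → Bool
cycAdj n a b = (toℕ b ≡ᵇ suc (toℕ a)) ∨ (toℕ a ≡ᵇ suc (toℕ b))
             ∨ ((toℕ a ≡ᵇ n ∸ 1) ∧ (toℕ b ≡ᵇ 0))
             ∨ ((toℕ b ≡ᵇ n ∸ 1) ∧ (toℕ a ≡ᵇ 0))

wheelAdj : (n : ℕ) → Fin (suc n) → Fin (suc n) → Bool
wheelAdj n zero zero = false
wheelAdj n zero (suc b) = true
wheelAdj n (suc a) zero = true
wheelAdj n (suc a) (suc b) = not (a =ᶠ b) ∧ cycAdj n a b

wheelSize : ℕ → ℕ
wheelSize n = suc n

-- Black N adj S v : v is eventually coloured black when starting
-- from exactly the set S black: either v ∈ S, or some black u adjacent to v has
-- all neighbours other than v black (so v is u's unique white neighbour and is forced).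
data Black (N : ℕ) (adj : Adj N) (S : Subset N) : Fin N → Set where
  init  : ∀ {v} → v ∈ S → Black N adj S v
  force : ∀ {v} (u : Fin N) → Black N adj S u → T (adj u v) →
          (∀ x → T (adj u x) → x ≢ v → Black N adj S x) → Black N adj S v

IsZeroForcingSet : (N : ℕ) → Adj N → Subset N → Set
IsZeroForcingSet N adj S = ∀ v → Black N adj S v

ZeroForcingNumber : (N : ℕ) → Adj N → ℕ → Set
ZeroForcingNumber N adj k =
  (Σ (Subset N) λ S → IsZeroForcingSet N adj S × ∣ S ∣ ≡ k) ×
  (∀ S → IsZeroForcingSet N adj S → k ≤ ∣ S ∣)

-- The vertices of L(W_n) are the n spokes and the n rims of the wheel.  The spokes together with
-- the rim (1,2) form a zero forcing set: the spoke at cycle vertex v has all its neighbours black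
-- except the rim leaving v, which it forces, and this runs around the cycle.
--
-- For the lower bound we use that a zero forcing set meets every fort, a nonempty vertex set no
-- outside vertex of which has exactly one neighbour in it.  Three kinds of forts are used: all
-- rims; the complement of S when it meets every vertex of the wheel; and two spokes together with
-- the rims of a cycle path joining their ends.  If S contains every spoke, the first fort adds a
-- rim.  Otherwise the second gives a spoke of S both of whose rims lie in S, and the third makes
-- each missing spoke after it be paid for by a later rim of S, so that S has n + 1 elements.

module Submission where

open import Defs
open import Data.Bool using (Bool; true; false; _∧_; _∨_; not; T; T?; if_then_else_)
open import Data.Bool.Properties using (∧-zeroʳ; ∨-zeroʳ; T-∧; T-∨; T-≡; T-not-≡)
open import Data.Empty using (⊥; ⊥-elim)
open import Data.Fin using (Fin; toℕ; fromℕ<) renaming (zero to fzero; suc to fsuc)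
open import Data.Fin.Properties using (toℕ<n; toℕ-fromℕ<; toℕ-injective) renaming (_<?_ to _<ᶠ?_)
open import Data.Fin.Subset using (Subset; _∈_; ∣_∣)
open import Data.Vec using ([]; _∷_; here; there)
import Data.Vec as Vec
import Data.Vec.Properties as Vecₚ
open import Data.List using (List; []; _∷_; _++_; length; map; concatMap; filter; lookup; allFin; tabulate)
open import Data.Bool.ListAction using (any)
open import Data.List.Properties
  using (map-∘; map-++; map-tabulate; map-concatMap; concatMap-map; concatMap-cong; concatMap-++;
         length-map; tabulate-cong; ++-identityʳ; ∷-injectiveˡ; ∷-injectiveʳ)
open import Data.Nat using (ℕ; zero; suc; _+_; _*_; _∸_; _<_; _≤_; _≡ᵇ_; _<ᵇ_; z≤n; s≤s; _≟_; _<?_)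
open import Data.Nat.Properties
open import Data.Product using (Σ; _×_; _,_; proj₁; proj₂; swap)
open import Data.Sum using (_⊎_; inj₁; inj₂; [_,_]′)
open import Data.Unit using (⊤; tt)
open import Function using (_∘_; _⇔_; mk⇔)
open import Function.Bundles using (Equivalence)
open import Relation.Nullary using (¬_; Dec; yes; no; does)
open import Relation.Binary.PropositionalEquality

open Equivalence using (to; from)
open import Algebra.Properties.CommutativeSemigroup +-commutativeSemigroup using (interchange)

≡ᵇ-true : ∀ {m k} → m ≡ k → (m ≡ᵇ k) ≡ true
≡ᵇ-true {m} {k} m≡k = to T-≡ (≡⇒≡ᵇ m k m≡k)

≡ᵇ-false : ∀ {m k} → m ≢ k → (m ≡ᵇ k) ≡ false
≡ᵇ-false {m} {k} m≢k with m ≡ᵇ k in eq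
... | true  = ⊥-elim (m≢k (≡ᵇ⇒≡ m k (subst T (sym eq) tt)))
... | false = refl

<ᵇ-true : ∀ {m k} → m < k → (m <ᵇ k) ≡ true
<ᵇ-true m<k = to T-≡ (<⇒<ᵇ m<k)

<ᵇ-false : ∀ {m k} → k ≤ m → (m <ᵇ k) ≡ false
<ᵇ-false {m} {k} k≤m with m <ᵇ k in eq
... | true  = ⊥-elim (<⇒≱ (<ᵇ⇒< m k (subst T (sym eq) tt)) k≤m)
... | false = refl

range : ℕ → ℕ → List ℕ
range k zero    = []
range k (suc m) = k ∷ range (suc k) m

Within : ℕ → ℕ → ℕ → Set
Within k m j = k ≤ j × j < k + m

within-head : ∀ k m → Within k (suc m) k
within-head k m = ≤-refl , m<m+n k (s≤s z≤n)

within-tail : ∀ {k m j} → Within (suc k) m j → Within k (suc m) j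
within-tail {k} {m} {j} (k<j , j<) = ≤-trans (n≤1+n k) k<j , subst (j <_) (sym (+-suc k m)) j<

length-range : ∀ k m → length (range k m) ≡ m
length-range k zero    = refl
length-range k (suc m) = cong suc (length-range (suc k) m)

range-++ : ∀ k a b → range k (a + b) ≡ range k a ++ range (k + a) b
range-++ k zero    b = cong (λ z → range z b) (sym (+-identityʳ k))
range-++ k (suc a) b =
  cong (k ∷_) (trans (range-++ (suc k) a b) (cong (λ z → range (suc k) a ++ range z b) (sym (+-suc k a))))

range-∷ʳ : ∀ k m → range k (suc m) ≡ range k m ++ (k + m) ∷ []
range-∷ʳ k m = trans (cong (range k) (+-comm 1 m)) (range-++ k m 1)

map-suc-range : ∀ k m → map suc (range k m) ≡ range (suc k) m
map-suc-range k zero    = refl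
map-suc-range k (suc m) = cong (suc k ∷_) (map-suc-range (suc k) m)

map-range-+ : {B : Set} (f : ℕ → B) (c k m : ℕ) → map f (range (c + k) m) ≡ map (λ j → f (c + j)) (range k m)
map-range-+ f c k zero    = refl
map-range-+ f c k (suc m) =
  cong (f (c + k) ∷_) (trans (cong (λ z → map f (range z m)) (sym (+-suc c k))) (map-range-+ f c (suc k) m))

map-range-cong : {B : Set} (f g : ℕ → B) (k m : ℕ) → (∀ j → Within k m j → f j ≡ g j) →
                 map f (range k m) ≡ map g (range k m)
map-range-cong f g k zero    f≗g = refl
map-range-cong f g k (suc m) f≗g =
  cong₂ _∷_ (f≗g k (within-head k m)) (map-range-cong f g (suc k) m (λ j w → f≗g j (within-tail w)))

tabulate-+toℕ : ∀ k m → tabulate {n = m} (λ i → k + toℕ i) ≡ range k m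
tabulate-+toℕ k zero    = refl
tabulate-+toℕ k (suc m) =
  cong₂ _∷_ (+-identityʳ k) (trans (tabulate-cong (λ i → +-suc k (toℕ i))) (tabulate-+toℕ (suc k) m))

map-toℕ-allFin : ∀ m → map toℕ (allFin m) ≡ range 0 m
map-toℕ-allFin m = trans (map-tabulate (λ i → i) toℕ) (tabulate-+toℕ 0 m)

lookup-≡-range : {A B : Set} (f : A → B) (g : ℕ → B) (xs : List A) (k m : ℕ) → map f xs ≡ map g (range k m) →
                 (i : Fin (length xs)) → f (lookup xs i) ≡ g (k + toℕ i)
lookup-≡-range f g (x ∷ xs) k (suc m) eq fzero    = trans (∷-injectiveˡ eq) (cong g (sym (+-identityʳ k)))
lookup-≡-range f g (x ∷ xs) k (suc m) eq (fsuc i) =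
  trans (lookup-≡-range f g xs (suc k) m (∷-injectiveʳ eq) i) (cong g (sym (+-suc k (toℕ i))))

length-≡-range : {A B : Set} (f : A → B) (g : ℕ → B) (xs : List A) (k m : ℕ) → map f xs ≡ map g (range k m) →
                 length xs ≡ m
length-≡-range f g xs k m eq =
  trans (sym (length-map f xs)) (trans (cong length eq) (trans (length-map g (range k m)) (length-range k m)))

filterᵇ : {A : Set} → (A → Bool) → List A → List A
filterᵇ p []       = []
filterᵇ p (x ∷ xs) = if p x then x ∷ filterᵇ p xs else filterᵇ p xs

filter≡filterᵇ : {A : Set} {P : A → Set} (P? : ∀ x → Dec (P x)) (xs : List A) →
                 filter P? xs ≡ filterᵇ (λ x → does (P? x)) xs
filter≡filterᵇ P? []       = refl
filter≡filterᵇ P? (x ∷ xs) with does (P? x)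
... | true  = cong (x ∷_) (filter≡filterᵇ P? xs)
... | false = filter≡filterᵇ P? xs

filterᵇ-++ : {A : Set} (p : A → Bool) (xs ys : List A) → filterᵇ p (xs ++ ys) ≡ filterᵇ p xs ++ filterᵇ p ys
filterᵇ-++ p []       ys = refl
filterᵇ-++ p (x ∷ xs) ys with p x
... | true  = cong (x ∷_) (filterᵇ-++ p xs ys)
... | false = filterᵇ-++ p xs ys

map-filterᵇ : {A B : Set} (h : A → B) (p : A → Bool) (q : B → Bool) → (∀ x → p x ≡ q (h x)) →
              ∀ xs → map h (filterᵇ p xs) ≡ filterᵇ q (map h xs)
map-filterᵇ h p q p≗q∘h []       = refl
map-filterᵇ h p q p≗q∘h (x ∷ xs) rewrite sym (p≗q∘h x) with p x
... | true  = cong (h x ∷_) (map-filterᵇ h p q p≗q∘h xs)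
... | false = map-filterᵇ h p q p≗q∘h xs

filterᵇ-concatMap : {A B : Set} (p : B → Bool) (g : A → List B) (xs : List A) →
                    filterᵇ p (concatMap g xs) ≡ concatMap (filterᵇ p ∘ g) xs
filterᵇ-concatMap p g []       = refl
filterᵇ-concatMap p g (x ∷ xs) =
  trans (filterᵇ-++ p (g x) (concatMap g xs)) (cong (filterᵇ p (g x) ++_) (filterᵇ-concatMap p g xs))

filterᵇ-filterᵇ : {A : Set} (p q : A → Bool) (xs : List A) → filterᵇ p (filterᵇ q xs) ≡ filterᵇ (λ x → q x ∧ p x) xs
filterᵇ-filterᵇ p q []       = refl
filterᵇ-filterᵇ p q (x ∷ xs) with q x
... | false = filterᵇ-filterᵇ p q xs
... | true with p x
...   | true  = cong (x ∷_) (filterᵇ-filterᵇ p q xs)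
...   | false = filterᵇ-filterᵇ p q xs

filterᵇ-range-none : (p : ℕ → Bool) (k m : ℕ) → (∀ j → Within k m j → p j ≡ false) → filterᵇ p (range k m) ≡ []
filterᵇ-range-none p k zero    _    = refl
filterᵇ-range-none p k (suc m) none rewrite none k (within-head k m) =
  filterᵇ-range-none p (suc k) m (λ j w → none j (within-tail w))

filterᵇ-range-all : (p : ℕ → Bool) (k m : ℕ) → (∀ j → Within k m j → p j ≡ true) →
                    filterᵇ p (range k m) ≡ range k m
filterᵇ-range-all p k zero    _   = refl
filterᵇ-range-all p k (suc m) all rewrite all k (within-head k m) =
  cong (k ∷_) (filterᵇ-range-all p (suc k) m (λ j w → all j (within-tail w)))

concatMap-range-singletons : {B : Set} (h : ℕ → List B) (f : ℕ → B) (k m : ℕ) →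
                             (∀ j → Within k m j → h j ≡ f j ∷ []) → concatMap h (range k m) ≡ map f (range k m)
concatMap-range-singletons h f k zero    _   = refl
concatMap-range-singletons h f k (suc m) one rewrite one k (within-head k m) =
  cong (f k ∷_) (concatMap-range-singletons h f (suc k) m (λ j w → one j (within-tail w)))

any-range⁻ : (p : ℕ → Bool) (k m : ℕ) → any p (range k m) ≡ true → Σ ℕ λ t → Within k m t × p t ≡ true
any-range⁻ p k zero    ()
any-range⁻ p k (suc m) found with p k in pk
... | true  = k , within-head k m , pk
... | false with any-range⁻ p (suc k) m found
...   | t , within , pt = t , within-tail within , pt

any-range⁺ : (p : ℕ → Bool) (k m t : ℕ) → Within k m t → p t ≡ true → any p (range k m) ≡ true
any-range⁺ p k zero    t (k≤t , t<k+0) _  = ⊥-elim (<⇒≱ t<k+0 (subst (_≤ t) (sym (+-identityʳ k)) k≤t))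
any-range⁺ p k (suc m) t (k≤t , t<k+m) pt with k ≟ t
... | yes refl rewrite pt = refl
... | no  k≢t  = trans (cong (p k ∨_) (any-range⁺ p (suc k) m t (≤∧≢⇒< k≤t k≢t , subst (t <_) (+-suc k m) t<k+m) pt))
                       (∨-zeroʳ (p k))

cycleAdjℕ : ℕ → ℕ → ℕ → Bool
cycleAdjℕ n a b =
  (b ≡ᵇ suc a) ∨ (a ≡ᵇ suc b) ∨ ((a ≡ᵇ n ∸ 1) ∧ (b ≡ᵇ 0)) ∨ ((b ≡ᵇ n ∸ 1) ∧ (a ≡ᵇ 0))

wheelAdjℕ : ℕ → ℕ → ℕ → Bool
wheelAdjℕ n zero    zero    = false
wheelAdjℕ n zero    (suc b) = true
wheelAdjℕ n (suc a) zero    = true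
wheelAdjℕ n (suc a) (suc b) = not (a ≡ᵇ b) ∧ cycleAdjℕ n a b

wheelAdj≡wheelAdjℕ : ∀ n (x y : Fin (suc n)) → wheelAdj n x y ≡ wheelAdjℕ n (toℕ x) (toℕ y)
wheelAdj≡wheelAdjℕ n fzero    fzero    = refl
wheelAdj≡wheelAdjℕ n fzero    (fsuc y) = refl
wheelAdj≡wheelAdjℕ n (fsuc x) fzero    = refl
wheelAdj≡wheelAdjℕ n (fsuc x) (fsuc y) = refl

endsℕ : ∀ {m} → Fin m × Fin m → ℕ × ℕ
endsℕ (a , b) = (toℕ a , toℕ b)

edgesAt : ℕ → ℕ → List (ℕ × ℕ)
edgesAt n k = map (k ,_) (filterᵇ (λ b → (k <ᵇ b) ∧ wheelAdjℕ n k b) (range 0 (suc n)))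

map-endsℕ-edges-wheel : ∀ n → map endsℕ (edges (suc n) (wheelAdj n)) ≡ concatMap (edgesAt n) (range 0 (suc n))
map-endsℕ-edges-wheel n =
  begin
    map endsℕ (filter adjacent? pairs)
  ≡⟨ cong (map endsℕ) (filter≡filterᵇ adjacent? pairs) ⟩
    map endsℕ (filterᵇ (λ x → does (adjacent? x)) pairs)
  ≡⟨ map-filterᵇ endsℕ _ adjacentℕ (λ x → wheelAdj≡wheelAdjℕ n (proj₁ x) (proj₂ x)) pairs ⟩
    filterᵇ adjacentℕ (map endsℕ pairs)
  ≡⟨ cong (filterᵇ adjacentℕ) map-endsℕ-pairs ⟩
    filterᵇ adjacentℕ (concatMap pairsℕ (range 0 N))
  ≡⟨ filterᵇ-concatMap adjacentℕ pairsℕ (range 0 N) ⟩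
    concatMap (filterᵇ adjacentℕ ∘ pairsℕ) (range 0 N)
  ≡⟨ concatMap-cong filter-pairsℕ (range 0 N) ⟩
    concatMap (edgesAt n) (range 0 N)
  ∎
  where
  open ≡-Reasoning
  N = suc n
  adjacent? = λ (p : Fin N × Fin N) → T? (wheelAdj n (proj₁ p) (proj₂ p))
  pairsAt : Fin N → List (Fin N × Fin N)
  pairsAt i = map (λ j → (i , j)) (filter (λ j → i <ᶠ? j) (allFin N))
  pairs = concatMap pairsAt (allFin N)
  adjacentℕ : ℕ × ℕ → Bool
  adjacentℕ (a , b) = wheelAdjℕ n a b
  pairsℕ : ℕ → List (ℕ × ℕ)
  pairsℕ k = map (k ,_) (filterᵇ (k <ᵇ_) (range 0 N))
  map-endsℕ-pairsAt : ∀ i → map endsℕ (pairsAt i) ≡ pairsℕ (toℕ i)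
  map-endsℕ-pairsAt i =
    begin
      map endsℕ (map (i ,_) (filter (i <ᶠ?_) (allFin N)))
    ≡⟨ sym (map-∘ _) ⟩
      map (λ j → (toℕ i , toℕ j)) (filter (i <ᶠ?_) (allFin N))
    ≡⟨ map-∘ _ ⟩
      map (toℕ i ,_) (map toℕ (filter (i <ᶠ?_) (allFin N)))
    ≡⟨ cong (map (toℕ i ,_) ∘ map toℕ) (filter≡filterᵇ (i <ᶠ?_) (allFin N)) ⟩
      map (toℕ i ,_) (map toℕ (filterᵇ (λ j → does (i <ᶠ? j)) (allFin N)))
    ≡⟨ cong (map (toℕ i ,_)) (map-filterᵇ toℕ _ (toℕ i <ᵇ_) (λ _ → refl) (allFin N)) ⟩
      map (toℕ i ,_) (filterᵇ (toℕ i <ᵇ_) (map toℕ (allFin N)))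
    ≡⟨ cong (map (toℕ i ,_) ∘ filterᵇ (toℕ i <ᵇ_)) (map-toℕ-allFin N) ⟩
      pairsℕ (toℕ i)
    ∎
  map-endsℕ-pairs : map endsℕ pairs ≡ concatMap pairsℕ (range 0 N)
  map-endsℕ-pairs =
    begin
      map endsℕ (concatMap pairsAt (allFin N))
    ≡⟨ map-concatMap endsℕ pairsAt (allFin N) ⟩
      concatMap (map endsℕ ∘ pairsAt) (allFin N)
    ≡⟨ concatMap-cong map-endsℕ-pairsAt (allFin N) ⟩
      concatMap (pairsℕ ∘ toℕ) (allFin N)
    ≡⟨ sym (concatMap-map pairsℕ toℕ (allFin N)) ⟩
      concatMap pairsℕ (map toℕ (allFin N))
    ≡⟨ cong (concatMap pairsℕ) (map-toℕ-allFin N) ⟩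
      concatMap pairsℕ (range 0 N)
    ∎
  filter-pairsℕ : ∀ k → filterᵇ adjacentℕ (pairsℕ k) ≡ edgesAt n k
  filter-pairsℕ k =
    trans (sym (map-filterᵇ (k ,_) _ adjacentℕ (λ _ → refl) (filterᵇ (k <ᵇ_) (range 0 N))))
          (cong (map (k ,_)) (filterᵇ-filterᵇ (wheelAdjℕ n k) (k <ᵇ_) (range 0 N)))

upperCycleNeighbour : ℕ → ℕ → ℕ → Bool
upperCycleNeighbour n a b = (a <ᵇ b) ∧ (not (a ≡ᵇ b) ∧ cycleAdjℕ n a b)

edgesAt-suc : ∀ n a → edgesAt n (suc a) ≡ map (λ b → (suc a , suc b)) (filterᵇ (upperCycleNeighbour n a) (range 0 n))
edgesAt-suc n a =
  trans (cong (map (suc a ,_) ∘ filterᵇ p) (sym (map-suc-range 0 n)))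
  (trans (cong (map (suc a ,_)) (sym (map-filterᵇ suc (p ∘ suc) p (λ _ → refl) (range 0 n))))
         (sym (map-∘ _)))
  where
  p : ℕ → Bool
  p b = (suc a <ᵇ b) ∧ wheelAdjℕ n (suc a) b

upperCycleNeighbours-inner : ∀ n a → 1 ≤ a → suc a < n → filterᵇ (upperCycleNeighbour n a) (range 0 n) ≡ suc a ∷ []
upperCycleNeighbours-inner n a@(suc _) (s≤s z≤n) 1+a<n =
  begin
    filterᵇ p (range 0 n)
  ≡⟨ cong (filterᵇ p ∘ range 0) (sym n≡) ⟩
    filterᵇ p (range 0 (suc a + suc r))
  ≡⟨ cong (filterᵇ p) (range-++ 0 (suc a) (suc r)) ⟩
    filterᵇ p (range 0 (suc a) ++ range (suc a) (suc r))
  ≡⟨ filterᵇ-++ p (range 0 (suc a)) (range (suc a) (suc r)) ⟩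
    filterᵇ p (range 0 (suc a)) ++ filterᵇ p (range (suc a) (suc r))
  ≡⟨ cong₂ _++_ (filterᵇ-range-none p 0 (suc a) below) successor ⟩
    suc a ∷ []
  ∎
  where
  open ≡-Reasoning
  p = upperCycleNeighbour n a
  r = n ∸ suc (suc a)
  n≡ : suc a + suc r ≡ n
  n≡ = trans (+-suc (suc a) r) (m+[n∸m]≡n 1+a<n)
  below : ∀ j → Within 0 (suc a) j → p j ≡ false
  below j (_ , j≤a) rewrite <ᵇ-false {a} {j} (≤-pred j≤a) = refl
  p-suc : p (suc a) ≡ true
  p-suc rewrite <ᵇ-true (n<1+n a) | ≡ᵇ-false {a} {suc a} (λ e → 1+n≢n (sym e)) | ≡ᵇ-true {suc a} refl = refl
  a<n∸1 : a < n ∸ 1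
  a<n∸1 = subst (a <_) (pred[m∸n]≡m∸[1+n] n 0) (suc[m]≤n⇒m≤pred[n] 1+a<n)
  above : ∀ j → Within (suc (suc a)) r j → p j ≡ false
  above j (a+2≤j , _)
    rewrite <ᵇ-true {a} {j} (≤-trans (n≤1+n _) a+2≤j)
          | ≡ᵇ-false {a} {j} (<⇒≢ (≤-trans (n≤1+n _) a+2≤j))
          | ≡ᵇ-false {j} {suc a} (λ e → <⇒≢ a+2≤j (sym e))
          | ≡ᵇ-false {a} {suc j} (<⇒≢ (≤-trans (n≤1+n _) (≤-trans a+2≤j (n≤1+n j))))
          | ≡ᵇ-false {a} {n ∸ 1} (<⇒≢ a<n∸1)
          | ∧-zeroʳ (j ≡ᵇ n ∸ 1) = refl
  successor : filterᵇ p (range (suc a) (suc r)) ≡ suc a ∷ []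
  successor rewrite p-suc = cong (suc a ∷_) (filterᵇ-range-none p (suc (suc a)) r above)

upperCycleNeighbours-last : ∀ n a → n ≤ suc a → filterᵇ (upperCycleNeighbour n a) (range 0 n) ≡ []
upperCycleNeighbours-last n a n≤1+a = filterᵇ-range-none (upperCycleNeighbour n a) 0 n
  (λ j (_ , j<n) → cong (_∧ (not (a ≡ᵇ j) ∧ cycleAdjℕ n a j)) (<ᵇ-false {a} {j} (≤-pred (≤-trans j<n n≤1+a))))

upperCycleNeighbours-0 : ∀ m → filterᵇ (upperCycleNeighbour (3 + m) 0) (range 0 (3 + m)) ≡ 1 ∷ (2 + m) ∷ []
upperCycleNeighbours-0 m = cong (1 ∷_) (
  begin
    filterᵇ p (range 2 (suc m))
  ≡⟨ cong (filterᵇ p) (range-∷ʳ 2 m) ⟩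
    filterᵇ p (range 2 m ++ (2 + m) ∷ [])
  ≡⟨ filterᵇ-++ p (range 2 m) _ ⟩
    filterᵇ p (range 2 m) ++ filterᵇ p ((2 + m) ∷ [])
  ≡⟨ cong₂ _++_ (filterᵇ-range-none p 2 m inner) last ⟩
    (2 + m) ∷ []
  ∎)
  where
  open ≡-Reasoning
  p = upperCycleNeighbour (3 + m) 0
  inner : ∀ j → Within 2 m j → p j ≡ false
  inner (suc (suc j)) (_ , s≤s (s≤s j<m)) rewrite ≡ᵇ-false {j} {m} (λ e → n≮n m (subst (_< m) e j<m)) = refl
  inner (suc zero) (s≤s () , _)
  last : filterᵇ p ((2 + m) ∷ []) ≡ (2 + m) ∷ []
  last rewrite ≡ᵇ-true {m} {m} refl = refl

-- The edges in the order of Defs.edges: the n spokes (0 , v+1), then (1 , 2), (1 , n), and (d , d+1) for 2 ≤ d < n.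
rimEdgeAt : ℕ → ℕ → ℕ × ℕ
rimEdgeAt n zero          = (1 , 2)
rimEdgeAt n (suc zero)    = (1 , n)
rimEdgeAt n (suc (suc d)) = (suc (suc d) , suc (suc (suc d)))

edgeAt : ℕ → ℕ → ℕ × ℕ
edgeAt n k = if k <ᵇ n then (0 , suc k) else rimEdgeAt n (k ∸ n)

edgeAt-spoke : ∀ n k → k < n → edgeAt n k ≡ (0 , suc k)
edgeAt-spoke n k k<n rewrite <ᵇ-true k<n = refl

edgeAt-rim : ∀ n d → edgeAt n (n + d) ≡ rimEdgeAt n d
edgeAt-rim n d rewrite <ᵇ-false {n + d} {n} (m≤m+n n d) | m+n∸m≡n n d = refl

map-endsℕ-edges-wheel-enumerated : ∀ m → let n = 3 + m in
  map endsℕ (edges (suc n) (wheelAdj n)) ≡ map (edgeAt n) (range 0 (n + n))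
map-endsℕ-edges-wheel-enumerated m = trans (map-endsℕ-edges-wheel n) (trans bySmallerEnd (sym byIndex))
  where
  open ≡-Reasoning
  n = 3 + m
  listing = map (0 ,_) (range 1 n) ++ ((1 , 2) ∷ (1 , n) ∷ (map (λ j → (j , suc j)) (range 2 (suc m)) ++ []))
  edgesAt-0 : edgesAt n 0 ≡ map (0 ,_) (range 1 n)
  edgesAt-0 = cong (map (0 ,_))
    (filterᵇ-range-all (λ b → (0 <ᵇ b) ∧ wheelAdjℕ n 0 b) 1 n (λ { (suc j) _ → refl ; zero (() , _) }))
  edgesAt-1 : edgesAt n 1 ≡ (1 , 2) ∷ (1 , n) ∷ []
  edgesAt-1 = trans (edgesAt-suc n 0) (cong (map _) (upperCycleNeighbours-0 m))
  edgesAt-n : edgesAt n n ≡ []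
  edgesAt-n = trans (edgesAt-suc n (2 + m)) (cong (map _) (upperCycleNeighbours-last n (2 + m) ≤-refl))
  edgesAt-inner : concatMap (edgesAt n) (range 2 (suc m)) ≡ map (λ j → (j , suc j)) (range 2 (suc m))
  edgesAt-inner = concatMap-range-singletons (edgesAt n) (λ j → (j , suc j)) 2 (suc m)
    (λ { (suc a) (s≤s 1≤a , 1+a<n) → trans (edgesAt-suc n a) (cong (map _) (upperCycleNeighbours-inner n a 1≤a 1+a<n)) })
  bySmallerEnd : concatMap (edgesAt n) (range 0 (suc n)) ≡ listing
  bySmallerEnd =
    begin
      edgesAt n 0 ++ (edgesAt n 1 ++ concatMap (edgesAt n) (range 2 (suc (suc m))))
    ≡⟨ cong₂ (λ x y → x ++ (y ++ concatMap (edgesAt n) (range 2 (suc (suc m))))) edgesAt-0 edgesAt-1 ⟩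
      map (0 ,_) (range 1 n) ++ ((1 , 2) ∷ (1 , n) ∷ concatMap (edgesAt n) (range 2 (suc (suc m))))
    ≡⟨ cong (λ z → map (0 ,_) (range 1 n) ++ ((1 , 2) ∷ (1 , n) ∷ z))
         (trans (cong (concatMap (edgesAt n)) (range-∷ʳ 2 (suc m)))
         (trans (concatMap-++ (edgesAt n) (range 2 (suc m)) (n ∷ []))
                (cong₂ _++_ edgesAt-inner (cong (_++ []) edgesAt-n)))) ⟩
      listing
    ∎
  spokes : map (edgeAt n) (range 0 n) ≡ map (0 ,_) (range 1 n)
  spokes = trans (map-range-cong (edgeAt n) (λ k → (0 , suc k)) 0 n (λ j w → edgeAt-spoke n j (proj₂ w)))
           (trans (map-∘ {g = 0 ,_} {f = suc} (range 0 n)) (cong (map (0 ,_)) (map-suc-range 0 n)))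
  rims : map (edgeAt n) (range n n) ≡ (1 , 2) ∷ (1 , n) ∷ (map (λ j → (j , suc j)) (range 2 (suc m)) ++ [])
  rims =
    begin
      map (edgeAt n) (range n n)
    ≡⟨ cong (λ z → map (edgeAt n) (range z n)) (sym (+-identityʳ n)) ⟩
      map (edgeAt n) (range (n + 0) n)
    ≡⟨ map-range-+ (edgeAt n) n 0 n ⟩
      map (λ j → edgeAt n (n + j)) (range 0 n)
    ≡⟨ map-range-cong _ (rimEdgeAt n) 0 n (λ j _ → edgeAt-rim n j) ⟩
      (1 , 2) ∷ (1 , n) ∷ map (rimEdgeAt n) (range 2 (suc m))
    ≡⟨ cong (λ z → (1 , 2) ∷ (1 , n) ∷ z)
         (trans (map-range-cong (rimEdgeAt n) (λ j → (j , suc j)) 2 (suc m)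
                   (λ { (suc (suc d)) _ → refl ; (suc zero) (s≤s () , _) ; zero (() , _) }))
                (sym (++-identityʳ _))) ⟩
      (1 , 2) ∷ (1 , n) ∷ (map (λ j → (j , suc j)) (range 2 (suc m)) ++ [])
    ∎
  byIndex : map (edgeAt n) (range 0 (n + n)) ≡ listing
  byIndex = trans (cong (map (edgeAt n)) (range-++ 0 n n)) (trans (map-++ (edgeAt n) (range 0 n) (range n n)) (cong₂ _++_ spokes rims))

Incident : ℕ × ℕ → ℕ → Set
Incident (a , b) v = a ≡ v ⊎ b ≡ v

shareEndℕ : ℕ × ℕ → ℕ × ℕ → Bool
shareEndℕ (a , b) (c , d) = not ((a ≡ᵇ c) ∧ (b ≡ᵇ d)) ∧ ((a ≡ᵇ c) ∨ (a ≡ᵇ d) ∨ (b ≡ᵇ c) ∨ (b ≡ᵇ d))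

shareEndℕ-sound : ∀ e f → T (shareEndℕ e f) → e ≢ f × Σ ℕ (λ v → Incident e v × Incident f v)
shareEndℕ-sound (a , b) (c , d) t = distinct , common (to T-∨ (proj₂ t₁₂))
  where
  t₁₂ = to T-∧ t
  distinct : (a , b) ≢ (c , d)
  distinct refl = subst T (to T-not-≡ (proj₁ t₁₂)) (from T-∧ (≡⇒≡ᵇ a a refl , ≡⇒≡ᵇ b b refl))
  common : T (a ≡ᵇ c) ⊎ T ((a ≡ᵇ d) ∨ (b ≡ᵇ c) ∨ (b ≡ᵇ d)) →
           Σ ℕ (λ v → Incident (a , b) v × Incident (c , d) v)
  common (inj₁ a=c) = a , inj₁ refl , inj₁ (sym (≡ᵇ⇒≡ a c a=c))
  common (inj₂ t′) with to T-∨ t′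
  ... | inj₁ a=d = a , inj₁ refl , inj₂ (sym (≡ᵇ⇒≡ a d a=d))
  ... | inj₂ t″ with to T-∨ t″
  ...   | inj₁ b=c = b , inj₂ refl , inj₁ (sym (≡ᵇ⇒≡ b c b=c))
  ...   | inj₂ b=d = b , inj₂ refl , inj₂ (sym (≡ᵇ⇒≡ b d b=d))

shareEndℕ-complete : ∀ e f v → e ≢ f → Incident e v → Incident f v → T (shareEndℕ e f)
shareEndℕ-complete (a , b) (c , d) v e≢f ie if = from T-∧ (from T-not-≡ notBoth , from (T-∨ {a ≡ᵇ c}) (common ie if))
  where
  notBoth : ((a ≡ᵇ c) ∧ (b ≡ᵇ d)) ≡ false
  notBoth with (a ≡ᵇ c) ∧ (b ≡ᵇ d) in eq
  ... | false = refl
  ... | true  = ⊥-elim (e≢f (cong₂ _,_ (≡ᵇ⇒≡ a c (proj₁ both)) (≡ᵇ⇒≡ b d (proj₂ both))))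
    where both = to T-∧ (subst T (sym eq) tt)
  right : ∀ {x y z} → T z → T (x ∨ y ∨ z)
  right {x} {y} tz = from (T-∨ {x}) (inj₂ (from (T-∨ {y}) (inj₂ tz)))
  common : Incident (a , b) v → Incident (c , d) v → T (a ≡ᵇ c) ⊎ T ((a ≡ᵇ d) ∨ (b ≡ᵇ c) ∨ (b ≡ᵇ d))
  common (inj₁ a=v) (inj₁ c=v) = inj₁ (≡⇒≡ᵇ a c (trans a=v (sym c=v)))
  common (inj₁ a=v) (inj₂ d=v) = inj₂ (from (T-∨ {a ≡ᵇ d}) (inj₁ (≡⇒≡ᵇ a d (trans a=v (sym d=v)))))
  common (inj₂ b=v) (inj₁ c=v) =
    inj₂ (from (T-∨ {a ≡ᵇ d}) (inj₂ (from (T-∨ {b ≡ᵇ c}) (inj₁ (≡⇒≡ᵇ b c (trans b=v (sym c=v)))))))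
  common (inj₂ b=v) (inj₂ d=v) = inj₂ (right {a ≡ᵇ d} {b ≡ᵇ c} (≡⇒≡ᵇ b d (trans b=v (sym d=v))))

Black-resp-≗ : ∀ {N} (adj adj′ : Adj N) → (∀ i j → adj i j ≡ adj′ i j) →
               ∀ {S v} → Black N adj S v → Black N adj′ S v
Black-resp-≗ adj adj′ eq (init v∈S)              = init v∈S
Black-resp-≗ adj adj′ eq (force u black-u uv others) =
  force u (Black-resp-≗ adj adj′ eq black-u) (subst T (eq u _) uv)
    (λ x ux x≢v → Black-resp-≗ adj adj′ eq (others x (subst T (sym (eq u x)) ux) x≢v))

ZeroForcingNumber-resp-≗ : ∀ {N k} (adj adj′ : Adj N) → (∀ i j → adj i j ≡ adj′ i j) →
                           ZeroForcingNumber N adj k → ZeroForcingNumber N adj′ k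
ZeroForcingNumber-resp-≗ adj adj′ eq ((S , zfs , size) , minimal) =
  (S , (λ v → Black-resp-≗ adj adj′ eq (zfs v)) , size) ,
  (λ S′ zfs′ → minimal S′ (λ v → Black-resp-≗ adj′ adj (λ i j → sym (eq i j)) (zfs′ v)))

IsFort : (N : ℕ) → Adj N → (Fin N → Bool) → Set
IsFort N adj F = ∀ u v → F u ≡ false → F v ≡ true → T (adj u v) →
                 Σ (Fin N) λ x → F x ≡ true × x ≢ v × T (adj u x)

-- A vertex outside a fort never has a unique white neighbour inside it, so the fort stays white.
fort-never-black : ∀ {N adj S} F → IsFort N adj F → (∀ v → F v ≡ true → v ∈ S → ⊥) →
                   ∀ v → Black N adj S v → F v ≡ true → ⊥
fort-never-black F fort disjoint v (init v∈S) v∈F = disjoint v v∈F v∈S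
fort-never-black F fort disjoint v (force u black-u uv others) v∈F with F u in u∈?F
... | true  = fort-never-black F fort disjoint u black-u u∈?F
... | false with fort u v u∈?F v∈F uv
...   | x , x∈F , x≢v , ux = fort-never-black F fort disjoint x (others x ux x≢v) x∈F

-- Reduction modulo n; only ever applied to indices below n + n.
wrap : ℕ → ℕ → ℕ
wrap n k = if k <ᵇ n then k else k ∸ n

module Cycle (m : ℕ) where

  n : ℕ
  n = 3 + m

  next : ℕ → ℕ
  next w = if suc w <ᵇ n then suc w else 0

  prev : ℕ → ℕ
  prev c = wrap n (c + (2 + m))

  next<n : ∀ w → next w < n
  next<n w with suc w <ᵇ n in eq
  ... | true  = <ᵇ⇒< (suc w) n (subst T (sym eq) tt)
  ... | false = s≤s z≤n

  next-inner : ∀ w → suc w < n → next w ≡ suc w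
  next-inner w 1+w<n rewrite <ᵇ-true 1+w<n = refl

  next-last : next (2 + m) ≡ 0
  next-last rewrite <ᵇ-false {3 + m} {n} ≤-refl = refl

  data NextView (w : ℕ) : Set where
    notLast : suc w < n → NextView w
    isLast  : w ≡ 2 + m → NextView w

  nextView : ∀ w → w < n → NextView w
  nextView w w<n with m≤n⇒m<n∨m≡n w<n
  ... | inj₁ 1+w<n = notLast 1+w<n
  ... | inj₂ 1+w≡n = isLast (suc-injective 1+w≡n)

  next≢id : ∀ w → w < n → next w ≢ w
  next≢id w w<n with nextView w w<n
  ... | notLast 1+w<n rewrite next-inner w 1+w<n = 1+n≢n
  ... | isLast refl rewrite next-last = λ ()

  next²≢id : ∀ w → w < n → next (next w) ≢ w
  next²≢id w w<n with nextView w w<n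
  ... | isLast refl rewrite next-last | next-inner 0 (s≤s (s≤s z≤n)) = λ e → 0≢1+n (suc-injective e)
  ... | notLast 1+w<n with nextView (suc w) 1+w<n
  ...   | notLast 2+w<n rewrite next-inner w 1+w<n | next-inner (suc w) 2+w<n = λ e → <⇒≢ (m<n⇒m<1+n (n<1+n w)) (sym e)
  ...   | isLast 1+w≡ rewrite next-inner w 1+w<n =
          λ e → 0≢1+n (trans (trans (sym (trans (cong next 1+w≡) next-last)) e) (suc-injective 1+w≡))

  wrap-low : ∀ k → k < n → wrap n k ≡ k
  wrap-low k k<n rewrite <ᵇ-true k<n = refl

  wrap-high : ∀ d → wrap n (n + d) ≡ d
  wrap-high d rewrite <ᵇ-false {n + d} {n} (m≤m+n n d) | m+n∸m≡n n d = refl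

  data IndexView (k : ℕ) : Set where
    low  : k < n → IndexView k
    high : (d : ℕ) → k ≡ n + d → IndexView k

  indexView : ∀ k → IndexView k
  indexView k with k <? n
  ... | yes k<n = low k<n
  ... | no  k≮n = high (k ∸ n) (sym (m+[n∸m]≡n (≮⇒≥ k≮n)))

  wrap<n : ∀ k → k < n + n → wrap n k < n
  wrap<n k k<2n with indexView k
  ... | low k<n rewrite wrap-low k k<n = k<n
  ... | high d refl rewrite wrap-high d = +-cancelˡ-< n d n k<2n

  next-wrap : ∀ t → suc t < n + n → next (wrap n t) ≡ wrap n (suc t)
  next-wrap t 1+t<2n with indexView t
  ... | high d refl =
        trans (cong next (wrap-high d))
        (trans (next-inner d (+-cancelˡ-< n (suc d) n (subst (_< n + n) (sym (+-suc n d)) 1+t<2n)))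
               (sym (trans (cong (wrap n) (sym (+-suc n d))) (wrap-high (suc d)))))
  ... | low t<n with nextView t t<n
  ...   | notLast 1+t<n rewrite wrap-low t t<n | wrap-low (suc t) 1+t<n = next-inner t 1+t<n
  ...   | isLast refl rewrite wrap-low _ t<n | next-last = sym (trans (cong (wrap n) (sym (+-identityʳ n))) (wrap-high 0))

  wrap≢wrap-suc : ∀ t → suc t < n + n → wrap n t ≢ wrap n (suc t)
  wrap≢wrap-suc t 1+t<2n eq = next≢id (wrap n t) (wrap<n t (<-trans (n<1+n t) 1+t<2n)) (trans (next-wrap t 1+t<2n) (sym eq))

  wrap-injective-window : ∀ i j → i < j → j < i + n → j < n + n → wrap n i ≢ wrap n j
  wrap-injective-window i j i<j j<i+n j<2n with indexView i | indexView j
  ... | low i<n    | low j<n rewrite wrap-low i i<n | wrap-low j j<n = <⇒≢ i<j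
  ... | low i<n    | high d refl rewrite wrap-low i i<n | wrap-high d =
        λ e → <⇒≢ (+-cancelˡ-< n d i (subst (n + d <_) (+-comm i n) j<i+n)) (sym e)
  ... | high d refl | low j<n = ⊥-elim (<⇒≱ (<-trans i<j j<n) (m≤m+n n d))
  ... | high d refl | high d′ refl rewrite wrap-high d | wrap-high d′ = <⇒≢ (+-cancelˡ-< n d d′ i<j)

  prev<n : ∀ c → c < n → prev c < n
  prev<n c c<n = wrap<n _ (+-mono-< c<n (n<1+n _))

  next-prev : ∀ c → c < n → next (prev c) ≡ c
  next-prev zero    _   rewrite wrap-low (2 + m) (n<1+n _) = next-last
  next-prev (suc c) c<n = trans (cong next prev≡) (next-inner c c<n)
    where
    prev≡ : prev (suc c) ≡ c
    prev≡ = trans (cong (wrap n) (trans (sym (+-suc c (2 + m))) (+-comm c n))) (wrap-high c)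

  prev≢id : ∀ c → c < n → prev c ≢ c
  prev≢id c c<n eq = next≢id c c<n (trans (cong next (sym eq)) (next-prev c c<n))

  next≡suc⇒ : ∀ w v → w < n → next w ≡ suc v → w ≡ v
  next≡suc⇒ w v w<n eq with nextView w w<n
  ... | notLast 1+w<n = suc-injective (trans (sym (next-inner w 1+w<n)) eq)
  ... | isLast refl with () ← trans (sym next-last) eq

∑< : ℕ → (ℕ → ℕ) → ℕ
∑< zero    f = 0
∑< (suc k) f = f 0 + ∑< k (f ∘ suc)

∑<-cong : ∀ k f g → (∀ j → j < k → f j ≡ g j) → ∑< k f ≡ ∑< k g
∑<-cong zero    f g f≗g = refl
∑<-cong (suc k) f g f≗g = cong₂ _+_ (f≗g 0 (s≤s z≤n)) (∑<-cong k _ _ (λ j j<k → f≗g (suc j) (s≤s j<k)))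

∑<-+ : ∀ a b f → ∑< (a + b) f ≡ ∑< a f + ∑< b (λ j → f (a + j))
∑<-+ zero    b f = refl
∑<-+ (suc a) b f = trans (cong (f 0 +_) (∑<-+ a b (f ∘ suc))) (sym (+-assoc (f 0) _ _))

∑<-suc : ∀ k f → ∑< (suc k) f ≡ ∑< k f + f k
∑<-suc k f = trans (cong (λ z → ∑< z f) (+-comm 1 k))
             (trans (∑<-+ k 1 f) (cong (∑< k f +_) (trans (+-identityʳ _) (cong f (+-identityʳ k)))))

∑<-distrib-+ : ∀ k f g → ∑< k (λ j → f j + g j) ≡ ∑< k f + ∑< k g
∑<-distrib-+ zero    f g = refl
∑<-distrib-+ (suc k) f g rewrite ∑<-distrib-+ k (f ∘ suc) (g ∘ suc) =
  interchange (f 0) (g 0) (∑< k (f ∘ suc)) (∑< k (g ∘ suc))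

∑<-≥ : ∀ k f j → j < k → f j ≤ ∑< k f
∑<-≥ (suc k) f zero    _         = m≤m+n (f 0) _
∑<-≥ (suc k) f (suc j) (s≤s j<k) = ≤-trans (∑<-≥ k (f ∘ suc) j j<k) (m≤n+m _ (f 0))

∑<-const : ∀ k c f → (∀ j → j < k → f j ≡ c) → ∑< k f ≡ k * c
∑<-const zero    c f _     = refl
∑<-const (suc k) c f const = cong₂ _+_ (const 0 (s≤s z≤n)) (∑<-const k c _ (λ j j<k → const (suc j) (s≤s j<k)))

∑<-rotate : ∀ k v₀ → v₀ < k → (g : ℕ → ℕ) →
            ∑< k (λ j → g (wrap k (v₀ + j))) ≡ ∑< k g
∑<-rotate k v₀ v₀<k g =
  begin
    ∑< k (g ∘ rot)
  ≡⟨ cong (λ z → ∑< z (g ∘ rot)) (trans (+-comm r v₀) v₀+r≡k) ⟨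
    ∑< (r + v₀) (g ∘ rot)
  ≡⟨ ∑<-+ r v₀ _ ⟩
    ∑< r (g ∘ rot) + ∑< v₀ (λ j → g (rot (r + j)))
  ≡⟨ cong₂ _+_ (∑<-cong r _ _ before-wrap) (∑<-cong v₀ _ _ after-wrap) ⟩
    ∑< r (λ j → g (v₀ + j)) + ∑< v₀ g
  ≡⟨ +-comm _ (∑< v₀ g) ⟩
    ∑< v₀ g + ∑< r (λ j → g (v₀ + j))
  ≡⟨ ∑<-+ v₀ r g ⟨
    ∑< (v₀ + r) g
  ≡⟨ cong (λ z → ∑< z g) v₀+r≡k ⟩
    ∑< k g
  ∎
  where
  open ≡-Reasoning
  rot : ℕ → ℕ
  rot j = wrap k (v₀ + j)
  r = k ∸ v₀
  v₀+r≡k : v₀ + r ≡ k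
  v₀+r≡k = m+[n∸m]≡n (<⇒≤ v₀<k)
  before-wrap : ∀ j → j < r → g (rot j) ≡ g (v₀ + j)
  before-wrap j j<r rewrite <ᵇ-true (subst (v₀ + j <_) v₀+r≡k (+-monoʳ-< v₀ j<r)) = refl
  after-wrap : ∀ j → j < v₀ → g (rot (r + j)) ≡ g j
  after-wrap j _ rewrite sym (+-assoc v₀ r j) | v₀+r≡k
                       | <ᵇ-false {k + j} {k} (m≤m+n k j) | m+n∸m≡n k j = refl

bit : Bool → ℕ
bit true  = 1
bit false = 0

search : (f : ℕ → Bool) (k : ℕ) → (Σ ℕ λ z → z < k × f z ≡ true) ⊎ (∀ z → z < k → f z ≡ false)
search f zero = inj₂ (λ z ())
search f (suc k) with search f k
... | inj₁ (z , z<k , fz) = inj₁ (z , m<n⇒m<1+n z<k , fz)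
... | inj₂ none with f k in fk
...   | true  = inj₁ (k , n<1+n k , fk)
...   | false = inj₂ λ z z<1+k → [ none z , (λ z≡k → trans (cong f z≡k) fk) ]′ (m≤n⇒m<n∨m≡n (≤-pred z<1+k))

-- Walking along positions t, each carrying a spoke and a rim, the debt records a missing spoke
-- not yet followed by a present rim.  Every position pays at least one unit, counting the debt.
module DebtWalk (spoke rim : ℕ → Bool) where

  weight : ℕ → ℕ
  weight t = bit (spoke t) + bit (rim t)

  step : Bool → Bool → Bool → Bool
  step debt s r = if r then false else (debt ∨ not s)

  Admissible : Bool → ℕ → ℕ → Set
  Admissible debt k zero      = ⊤
  Admissible debt k (suc len) = (debt ≡ true → spoke k ≡ true) × Admissible (step debt (spoke k) (rim k)) (suc k) len

  finalDebt : Bool → ℕ → ℕ → Bool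
  finalDebt debt k zero      = debt
  finalDebt debt k (suc len) = finalDebt (step debt (spoke k) (rim k)) (suc k) len

  finalDebt-suc : ∀ debt k len → finalDebt debt k (suc len) ≡ step (finalDebt debt k len) (spoke (k + len)) (rim (k + len))
  finalDebt-suc debt k zero      rewrite +-identityʳ k = refl
  finalDebt-suc debt k (suc len) rewrite +-suc k len = finalDebt-suc (step debt (spoke k) (rim k)) (suc k) len

  step-pays : ∀ debt s r → (debt ≡ true → s ≡ true) → suc (bit debt) ≤ (bit s + bit r) + bit (step debt s r)
  step-pays true  true  true  _ = ≤-refl
  step-pays true  true  false _ = ≤-refl
  step-pays true  false r     admissible with () ← admissible refl
  step-pays false true  true  _ = s≤s z≤n
  step-pays false true  false _ = ≤-refl
  step-pays false false true  _ = ≤-refl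
  step-pays false false false _ = ≤-refl

  walk-bound : ∀ debt k len → Admissible debt k len →
               len + bit debt ≤ ∑< len (λ j → weight (k + j)) + bit (finalDebt debt k len)
  walk-bound debt k zero      _                   = ≤-refl
  walk-bound debt k (suc len) (admissible , rest) =
    begin
      suc len + bit debt
    ≡⟨ cong suc (+-comm len (bit debt)) ⟩
      suc (bit debt) + len
    ≤⟨ +-monoˡ-≤ len (step-pays debt (spoke k) (rim k) admissible) ⟩
      (weight k + bit debt′) + len
    ≡⟨ trans (+-assoc (weight k) (bit debt′) len) (cong (weight k +_) (+-comm (bit debt′) len)) ⟩
      weight k + (len + bit debt′)
    ≤⟨ +-monoʳ-≤ (weight k) (walk-bound debt′ (suc k) len rest) ⟩
      weight k + (∑< len (λ j → weight (suc k + j)) + bit (finalDebt debt′ (suc k) len))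
    ≡⟨ sym (+-assoc (weight k) _ _) ⟩
      (weight k + ∑< len (λ j → weight (suc k + j))) + bit (finalDebt debt′ (suc k) len)
    ≡⟨ cong₂ (λ x y → (weight x + y) + bit (finalDebt debt′ (suc k) len))
             (sym (+-identityʳ k)) (∑<-cong len _ _ (λ j _ → cong weight (sym (+-suc k j)))) ⟩
      ∑< (suc len) (λ j → weight (k + j)) + bit (finalDebt debt k (suc len))
    ∎
    where
    open ≤-Reasoning
    debt′ = step debt (spoke k) (rim k)

  module _ (k₀ len₀ : ℕ)
    (separated : ∀ i j → k₀ ≤ i → i < j → j < k₀ + len₀ → spoke i ≡ false → spoke j ≡ false →
                 ¬ (∀ t → i ≤ t → t < j → rim t ≡ false)) where

    DebtWitness : Bool → ℕ → Set
    DebtWitness debt k = debt ≡ true →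
      Σ ℕ λ i → k₀ ≤ i × i < k × spoke i ≡ false × (∀ t → i ≤ t → t < k → rim t ≡ false)

    debtWitness-step : ∀ debt k → k₀ ≤ k → DebtWitness debt k → DebtWitness (step debt (spoke k) (rim k)) (suc k)
    debtWitness-step debt k k₀≤k witness indebted with rim k in rim-k
    debtWitness-step debt  k k₀≤k witness () | true
    debtWitness-step true  k k₀≤k witness _  | false with witness refl
    ... | i , k₀≤i , i<k , spoke-i , no-rims = i , k₀≤i , m<n⇒m<1+n i<k , spoke-i , no-rims′
      where
      no-rims′ : ∀ t → i ≤ t → t < suc k → rim t ≡ false
      no-rims′ t i≤t t<1+k =
        [ no-rims t i≤t , (λ t≡k → trans (cong rim t≡k) rim-k) ]′ (m≤n⇒m<n∨m≡n (≤-pred t<1+k))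
    debtWitness-step false k k₀≤k witness indebted | false with spoke k in spoke-k
    debtWitness-step false k k₀≤k witness () | false | true
    debtWitness-step false k k₀≤k witness _  | false | false =
      k , k₀≤k , n<1+n k , spoke-k , λ t k≤t t<1+k → trans (cong rim (≤-antisym (≤-pred t<1+k) k≤t)) rim-k

    admissible : ∀ debt k len → k₀ ≤ k → k + len ≤ k₀ + len₀ → DebtWitness debt k → Admissible debt k len
    admissible debt k zero      _     _     _       = tt
    admissible debt k (suc len) k₀≤k bound witness =
      spoke-k , admissible (step debt (spoke k) (rim k)) (suc k) len (≤-trans k₀≤k (n≤1+n k))
                  (subst (_≤ k₀ + len₀) (+-suc k len) bound) (debtWitness-step debt k k₀≤k witness)
      where
      k<end : k < k₀ + len₀
      k<end = <-≤-trans (subst (k <_) (sym (+-suc k len)) (s≤s (m≤m+n k len))) bound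
      spoke-k : debt ≡ true → spoke k ≡ true
      spoke-k indebted with witness indebted
      ... | i , k₀≤i , i<k , spoke-i , no-rims with spoke k in eq
      ...   | true  = refl
      ...   | false = ⊥-elim (separated i k k₀≤i i<k k<end spoke-i eq no-rims)

module Count (m : ℕ) where
  open Cycle m

  HitsRims : (ℕ → Bool) → Set
  HitsRims rim = ¬ (∀ w → w < n → rim w ≡ false)

  HitsStars : (ℕ → Bool) → (ℕ → Bool) → Set
  HitsStars spoke rim = ∀ z₀ → z₀ < n → spoke z₀ ≡ false →
    ¬ (∀ c → c < n → spoke c ≡ true → rim (prev c) ≡ false ⊎ rim c ≡ false)

  HitsArcs : (ℕ → Bool) → (ℕ → Bool) → Set
  HitsArcs spoke rim = ∀ i j → i < j → j < i + n → j < n + n →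
    spoke (wrap n i) ≡ false → spoke (wrap n j) ≡ false → ¬ (∀ t → i ≤ t → t < j → rim (wrap n t) ≡ false)

  module _ (spoke rim : ℕ → Bool) where

    total : ℕ
    total = ∑< n (bit ∘ spoke) + ∑< n (bit ∘ rim)

    count-all-spokes : (∀ z → z < n → spoke z ≡ true) → HitsRims rim → suc n ≤ total
    count-all-spokes all-spokes hits-rims with search rim n
    ... | inj₂ no-rim = ⊥-elim (hits-rims no-rim)
    ... | inj₁ (w , w<n , rim-w) =
      begin
        suc n
      ≡⟨ +-comm 1 n ⟩
        n + 1
      ≤⟨ +-mono-≤ (≤-reflexive (sym (trans (∑<-const n 1 _ (λ j j<n → cong bit (all-spokes j j<n))) (*-identityʳ n))))
                  (subst (_≤ ∑< n (bit ∘ rim)) (cong bit rim-w) (∑<-≥ n (bit ∘ rim) w w<n)) ⟩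
        total
      ∎
      where open ≤-Reasoning

    full-star : HitsStars spoke rim → ∀ z₀ → z₀ < n → spoke z₀ ≡ false →
                Σ ℕ λ v₀ → v₀ < n × spoke v₀ ≡ true × rim (prev v₀) ≡ true × rim v₀ ≡ true
    full-star hits-stars z₀ z₀<n spoke-z₀ with search (λ v → spoke v ∧ (rim (prev v) ∧ rim v)) n
    ... | inj₂ none = ⊥-elim (hits-stars z₀ z₀<n spoke-z₀ uncovered)
      where
      uncovered : ∀ c → c < n → spoke c ≡ true → rim (prev c) ≡ false ⊎ rim c ≡ false
      uncovered c c<n spoke-c with none c c<n
      ... | no-star rewrite spoke-c with rim (prev c)
      ...   | false = inj₁ refl
      ...   | true  = inj₂ no-star
    ... | inj₁ (v₀ , v₀<n , star) with spoke v₀ in s | rim (prev v₀) in p | rim v₀ in r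
    ...   | true | true | true = v₀ , v₀<n , s , p , r

    -- The star at v₀ contributes 2; walking once around the cycle from v₀ + 1, the remaining n - 1
    -- positions contribute n - 1, as the walk starts without debt and ends on the rim prev v₀ ∈ S.
    count-from-full-star : ∀ v₀ → v₀ < n → spoke v₀ ≡ true → rim (prev v₀) ≡ true → rim v₀ ≡ true →
                           HitsArcs spoke rim → suc n ≤ total
    count-from-full-star v₀ v₀<n spoke-v₀ rim-prev rim-v₀ hits-arcs =
      subst (suc n ≤_) rotated (+-monoʳ-≤ 2 walked)
      where
      open DebtWalk (spoke ∘ wrap n) (rim ∘ wrap n)
      len = 2 + m
      separated : ∀ i j → suc v₀ ≤ i → i < j → j < suc v₀ + len →
                  spoke (wrap n i) ≡ false → spoke (wrap n j) ≡ false →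
                  ¬ (∀ t → i ≤ t → t < j → rim (wrap n t) ≡ false)
      separated i j v₀<i i<j j<end = hits-arcs i j i<j
        (<-≤-trans j<end (≤-trans (+-monoˡ-≤ len v₀<i) (+-monoʳ-≤ i (n≤1+n len))))
        (<-≤-trans j<end (+-mono-≤ v₀<n (n≤1+n len)))
      debt-free-end : finalDebt false (suc v₀) len ≡ false
      debt-free-end = trans (finalDebt-suc false (suc v₀) (suc m))
                            (cong (step (finalDebt false (suc v₀) (suc m)) (spoke (wrap n (suc v₀ + suc m)))) last-rim)
        where
        last-rim : rim (wrap n (suc v₀ + suc m)) ≡ true
        last-rim = trans (cong (rim ∘ wrap n) (sym (+-suc v₀ (suc m)))) rim-prev
      walked : len ≤ ∑< len (λ j → weight (suc v₀ + j))
      walked = subst₂ _≤_ (+-identityʳ len)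
                 (trans (cong (λ d → ∑< len (λ j → weight (suc v₀ + j)) + bit d) debt-free-end) (+-identityʳ _))
                 (walk-bound false (suc v₀) len (admissible (suc v₀) len separated false (suc v₀) len ≤-refl ≤-refl (λ ())))
      star-weight : weight (v₀ + 0) ≡ 2
      star-weight rewrite +-identityʳ v₀ | wrap-low v₀ v₀<n | spoke-v₀ | rim-v₀ = refl
      rotated : 2 + ∑< len (λ j → weight (suc v₀ + j)) ≡ total
      rotated =
        begin
          2 + ∑< len (λ j → weight (suc v₀ + j))
        ≡⟨ cong₂ _+_ (sym star-weight) (∑<-cong len _ _ (λ j _ → cong weight (sym (+-suc v₀ j)))) ⟩
          ∑< n (λ j → weight (v₀ + j))
        ≡⟨ ∑<-rotate n v₀ v₀<n (λ v → bit (spoke v) + bit (rim v)) ⟩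
          ∑< n (λ v → bit (spoke v) + bit (rim v))
        ≡⟨ ∑<-distrib-+ n (bit ∘ spoke) (bit ∘ rim) ⟩
          total
        ∎
        where open ≡-Reasoning

    count : HitsRims rim → HitsStars spoke rim → HitsArcs spoke rim → suc n ≤ total
    count hits-rims hits-stars hits-arcs with search (not ∘ spoke) n
    ... | inj₂ no-missing = count-all-spokes (λ z z<n → not-false (no-missing z z<n)) hits-rims
      where
      not-false : ∀ {b} → not b ≡ false → b ≡ true
      not-false {true} _ = refl
    ... | inj₁ (z₀ , z₀<n , missing) with full-star hits-stars z₀ z₀<n (not-true missing)
      where
      not-true : ∀ {b} → not b ≡ true → b ≡ false
      not-true {false} _ = refl
    ...   | v₀ , v₀<n , spoke-v₀ , rim-prev , rim-v₀ = count-from-full-star v₀ v₀<n spoke-v₀ rim-prev rim-v₀ hits-arcs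

data WheelEdge : Set where
  spoke rim : ℕ → WheelEdge

spoke-injective : ∀ {v v′} → spoke v ≡ spoke v′ → v ≡ v′
spoke-injective refl = refl

rim-injective : ∀ {w w′} → rim w ≡ rim w′ → w ≡ w′
rim-injective refl = refl

_≟ᵉ_ : (x y : WheelEdge) → Dec (x ≡ y)
spoke v ≟ᵉ spoke v′ with v ≟ v′
... | yes refl = yes refl
... | no  v≢v′ = no λ { refl → v≢v′ refl }
spoke v ≟ᵉ rim w    = no λ ()
rim w   ≟ᵉ spoke v  = no λ ()
rim w   ≟ᵉ rim w′ with w ≟ w′
... | yes refl = yes refl
... | no  w≢w′ = no λ { refl → w≢w′ refl }

Incident-swap : ∀ e v → Incident (swap e) v ⇔ Incident e v
Incident-swap (a , b) v = mk⇔ Data.Sum.swap Data.Sum.swap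

Incident-two : ∀ {a b c d v₁ v₂} → v₁ ≢ v₂ → Incident (a , b) v₁ → Incident (a , b) v₂ →
               Incident (c , d) v₁ → Incident (c , d) v₂ → (a ≡ c × b ≡ d) ⊎ (a ≡ d × b ≡ c)
Incident-two v₁≢v₂ (inj₁ a₁) (inj₁ a₂) _ _ = ⊥-elim (v₁≢v₂ (trans (sym a₁) a₂))
Incident-two v₁≢v₂ (inj₂ b₁) (inj₂ b₂) _ _ = ⊥-elim (v₁≢v₂ (trans (sym b₁) b₂))
Incident-two v₁≢v₂ _ _ (inj₁ c₁) (inj₁ c₂) = ⊥-elim (v₁≢v₂ (trans (sym c₁) c₂))
Incident-two v₁≢v₂ _ _ (inj₂ d₁) (inj₂ d₂) = ⊥-elim (v₁≢v₂ (trans (sym d₁) d₂))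
Incident-two _ (inj₁ a₁) (inj₂ b₂) (inj₁ c₁) (inj₂ d₂) = inj₁ (trans a₁ (sym c₁) , trans b₂ (sym d₂))
Incident-two _ (inj₁ a₁) (inj₂ b₂) (inj₂ d₁) (inj₁ c₂) = inj₂ (trans a₁ (sym d₁) , trans b₂ (sym c₂))
Incident-two _ (inj₂ b₁) (inj₁ a₂) (inj₁ c₁) (inj₂ d₂) = inj₂ (trans a₂ (sym d₂) , trans b₁ (sym c₁))
Incident-two _ (inj₂ b₁) (inj₁ a₂) (inj₂ d₁) (inj₁ c₂) = inj₁ (trans a₂ (sym c₂) , trans b₁ (sym d₁))

module WheelEdges (m : ℕ) where
  open Cycle m

  Valid : WheelEdge → Set
  Valid (spoke v) = v < n
  Valid (rim w)   = w < n

  ends : WheelEdge → ℕ × ℕ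
  ends (spoke v) = (0 , suc v)
  ends (rim w)   = (suc w , suc (next w))

  Meets : WheelEdge → ℕ → Set
  Meets x v = Incident (ends x) v

  -- Position of rim w among the rim edges (1,2), (1,n), (2,3), ..., (n-1,n) of edgeAt.
  rimOffset : ℕ → ℕ
  rimOffset zero    = 0
  rimOffset (suc w) = if suc w ≡ᵇ 2 + m then 1 else 2 + w

  rimOfOffset : ℕ → ℕ
  rimOfOffset zero          = 0
  rimOfOffset (suc zero)    = 2 + m
  rimOfOffset (suc (suc d)) = suc d

  index : WheelEdge → ℕ
  index (spoke v) = v
  index (rim w)   = n + rimOffset w

  fromIndex : ℕ → WheelEdge
  fromIndex k = if k <ᵇ n then spoke k else rim (rimOfOffset (k ∸ n))

  data RimView : ℕ → Set where
    first : RimView 0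
    last  : RimView (2 + m)
    inner : ∀ w → 2 + w < n → RimView (suc w)

  rimView : ∀ w → w < n → RimView w
  rimView zero    _ = first
  rimView (suc w) 1+w<n with nextView (suc w) 1+w<n
  ... | notLast 2+w<n = inner w 2+w<n
  ... | isLast refl   = last

  rimOffset-last : rimOffset (2 + m) ≡ 1
  rimOffset-last rewrite ≡ᵇ-true {2 + m} refl = refl

  rimOffset-inner : ∀ w → 2 + w < n → rimOffset (suc w) ≡ 2 + w
  rimOffset-inner w 2+w<n rewrite ≡ᵇ-false {suc w} {2 + m} (λ e → <⇒≢ (≤-pred 2+w<n) (cong suc (suc-injective e))) = refl

  edgeAt-index : ∀ x → Valid x → edgeAt n (index x) ≡ ends x ⊎ edgeAt n (index x) ≡ swap (ends x)
  edgeAt-index (spoke v) v<n = inj₁ (edgeAt-spoke n v v<n)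
  edgeAt-index (rim w) w<n with rimView w w<n
  ... | first = inj₁ (trans (edgeAt-rim n 0) (cong (λ z → (1 , suc z)) (sym (next-inner 0 (s≤s (s≤s z≤n))))))
  ... | last  = inj₂ (trans (cong (edgeAt n ∘ (n +_)) rimOffset-last)
                     (trans (edgeAt-rim n 1) (cong (λ z → (suc z , n)) (sym next-last))))
  ... | inner w′ 2+w′<n = inj₁ (trans (cong (edgeAt n ∘ (n +_)) (rimOffset-inner w′ 2+w′<n))
                               (trans (edgeAt-rim n _) (cong (λ z → (2 + w′ , suc z)) (sym (next-inner (suc w′) 2+w′<n)))))

  incident-index⇔meets : ∀ x v → Valid x → Incident (edgeAt n (index x)) v ⇔ Meets x v
  incident-index⇔meets x v valid with edgeAt-index x valid
  ... | inj₁ eq = subst (λ e → Incident e v ⇔ Meets x v) (sym eq) (mk⇔ (λ i → i) (λ i → i))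
  ... | inj₂ eq = subst (λ e → Incident e v ⇔ Meets x v) (sym eq) (Incident-swap (ends x) v)

  index<2n : ∀ x → Valid x → index x < n + n
  index<2n (spoke v) v<n = <-≤-trans v<n (m≤m+n n n)
  index<2n (rim w) w<n with rimView w w<n
  ... | first = +-monoʳ-< n (s≤s z≤n)
  ... | last  = subst (_< n + n) (sym (cong (n +_) rimOffset-last)) (+-monoʳ-< n (s≤s (s≤s z≤n)))
  ... | inner w′ 2+w′<n = subst (_< n + n) (sym (cong (n +_) (rimOffset-inner w′ 2+w′<n))) (+-monoʳ-< n 2+w′<n)

  fromIndex-low : ∀ k → k < n → fromIndex k ≡ spoke k
  fromIndex-low k k<n rewrite <ᵇ-true k<n = refl

  fromIndex-high : ∀ d → fromIndex (n + d) ≡ rim (rimOfOffset d)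
  fromIndex-high d rewrite <ᵇ-false {n + d} {n} (m≤m+n n d) | m+n∸m≡n n d = refl

  fromIndex-index : ∀ x → Valid x → fromIndex (index x) ≡ x
  fromIndex-index (spoke v) v<n = fromIndex-low v v<n
  fromIndex-index (rim w) w<n with rimView w w<n
  ... | first = trans (cong fromIndex (+-identityʳ n)) (trans (sym (cong fromIndex (+-identityʳ n))) (fromIndex-high 0))
  ... | last  = trans (cong (fromIndex ∘ (n +_)) rimOffset-last) (fromIndex-high 1)
  ... | inner w′ 2+w′<n = trans (cong (fromIndex ∘ (n +_)) (rimOffset-inner w′ 2+w′<n)) (fromIndex-high _)

  index-fromIndex : ∀ k → k < n + n → index (fromIndex k) ≡ k
  index-fromIndex k k<2n with indexView k
  ... | low k<n = cong index (fromIndex-low k k<n)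
  ... | high d refl = trans (cong index (fromIndex-high d)) (cong (n +_) (rimOffset-rimOfOffset d (+-cancelˡ-< n d n k<2n)))
    where
    rimOffset-rimOfOffset : ∀ d → d < n → rimOffset (rimOfOffset d) ≡ d
    rimOffset-rimOfOffset zero          _     = refl
    rimOffset-rimOfOffset (suc zero)    _     = rimOffset-last
    rimOffset-rimOfOffset (suc (suc d)) 2+d<n = rimOffset-inner d 2+d<n

  fromIndex-valid : ∀ k → k < n + n → Valid (fromIndex k)
  fromIndex-valid k k<2n with indexView k
  ... | low k<n = subst Valid (sym (fromIndex-low k k<n)) k<n
  ... | high d refl = subst Valid (sym (fromIndex-high d)) (rimOfOffset<n d (+-cancelˡ-< n d n k<2n))
    where
    rimOfOffset<n : ∀ d → d < n → rimOfOffset d < n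
    rimOfOffset<n zero          _     = s≤s z≤n
    rimOfOffset<n (suc zero)    _     = n<1+n _
    rimOfOffset<n (suc (suc d)) 2+d<n = <-trans (n<1+n _) 2+d<n

  ends-distinct : ∀ x → Valid x → proj₁ (ends x) ≢ proj₂ (ends x)
  ends-distinct (spoke v) _   ()
  ends-distinct (rim w)   w<n eq = next≢id w w<n (sym (suc-injective eq))

  ends<n+1 : ∀ x → Valid x → proj₁ (ends x) ≤ n × proj₂ (ends x) ≤ n
  ends<n+1 (spoke v) v<n = z≤n , v<n
  ends<n+1 (rim w)   w<n = w<n , next<n w

  meets-two⇒≡ : ∀ x y → Valid x → Valid y → ∀ v₁ v₂ → v₁ ≢ v₂ →
                Meets x v₁ → Meets x v₂ → Meets y v₁ → Meets y v₂ → x ≡ y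
  meets-two⇒≡ x y valid-x valid-y v₁ v₂ v₁≢v₂ x₁ x₂ y₁ y₂ =
    same-ends x y valid-y (Incident-two v₁≢v₂ x₁ x₂ y₁ y₂)
    where
    same-ends : ∀ x y → Valid y →
      (proj₁ (ends x) ≡ proj₁ (ends y) × proj₂ (ends x) ≡ proj₂ (ends y)) ⊎
      (proj₁ (ends x) ≡ proj₂ (ends y) × proj₂ (ends x) ≡ proj₁ (ends y)) → x ≡ y
    same-ends (spoke v) (spoke v′) _ (inj₁ (_ , eq)) = cong spoke (suc-injective eq)
    same-ends (spoke v) (spoke v′) _ (inj₂ (() , _))
    same-ends (spoke v) (rim w)    _ (inj₁ (() , _))
    same-ends (spoke v) (rim w)    _ (inj₂ (() , _))
    same-ends (rim w)   (spoke v)  _ (inj₁ (() , _))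
    same-ends (rim w)   (spoke v)  _ (inj₂ (_ , ()))
    same-ends (rim w)   (rim w′)   _ (inj₁ (eq , _)) = cong rim (suc-injective eq)
    -- Both orientations agreeing would make the cycle a 2-cycle.
    same-ends (rim w)   (rim w′)   w′<n (inj₂ (eq₁ , eq₂)) =
      ⊥-elim (next²≢id w′ w′<n (trans (cong next (sym (suc-injective eq₁))) (suc-injective eq₂)))

  edgeAt-injective : ∀ k l → k < n + n → l < n + n → edgeAt n k ≡ edgeAt n l → k ≡ l
  edgeAt-injective k l k<2n l<2n eq = trans (sym (index-fromIndex k k<2n)) (trans (cong index x≡y) (index-fromIndex l l<2n))
    where
    x = fromIndex k
    y = fromIndex l
    valid-x = fromIndex-valid k k<2n
    valid-y = fromIndex-valid l l<2n
    same : ∀ v → Meets y v → Meets x v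
    same v meets-y =
      to (incident-index⇔meets x v valid-x)
        (subst (λ e → Incident e v) (cong (edgeAt n) (sym (index-fromIndex k k<2n)))
        (subst (λ e → Incident e v) (sym eq)
        (subst (λ e → Incident e v) (cong (edgeAt n) (index-fromIndex l l<2n))
        (from (incident-index⇔meets y v valid-y) meets-y))))
    x≡y : x ≡ y
    x≡y = meets-two⇒≡ x y valid-x valid-y _ _ (ends-distinct y valid-y)
            (same _ (inj₁ refl)) (same _ (inj₂ refl)) (inj₁ refl) (inj₂ refl)

  SharesEnds : (WheelEdge → Bool) → Set
  SharesEnds F = ∀ v y → Valid y → F y ≡ true → Meets y v →
                 Σ WheelEdge λ z → Valid z × F z ≡ true × z ≢ y × Meets z v

  CoversWheel : (WheelEdge → Bool) → Set
  CoversWheel F = ∀ v → v ≤ n → Σ WheelEdge λ z → Valid z × F z ≡ true × Meets z v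

  module Arc (i j : ℕ) (i<j : i < j) (j<i+n : j < i + n) (j<2n : j < n + n) where

    arc : WheelEdge → Bool
    arc (spoke v) = (v ≡ᵇ wrap n i) ∨ (v ≡ᵇ wrap n j)
    arc (rim w)   = any (λ t → w ≡ᵇ wrap n t) (range i (j ∸ i))

    private
      i+[j∸i]≡j : i + (j ∸ i) ≡ j
      i+[j∸i]≡j = m+[n∸m]≡n (<⇒≤ i<j)
      i<2n = <-trans i<j j<2n
      wrap-i≢wrap-j = wrap-injective-window i j i<j j<i+n j<2n

    arc-spoke-i : arc (spoke (wrap n i)) ≡ true
    arc-spoke-i rewrite ≡ᵇ-true {wrap n i} refl = refl

    arc-spoke-j : arc (spoke (wrap n j)) ≡ true
    arc-spoke-j rewrite ≡ᵇ-true {wrap n j} refl = ∨-zeroʳ _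

    arc-rim : ∀ t → i ≤ t → t < j → arc (rim (wrap n t)) ≡ true
    arc-rim t i≤t t<j = any-range⁺ _ i (j ∸ i) t (i≤t , subst (t <_) (sym i+[j∸i]≡j) t<j) (≡ᵇ-true {wrap n t} refl)

    arc-spoke⁻ : ∀ v → arc (spoke v) ≡ true → v ≡ wrap n i ⊎ v ≡ wrap n j
    arc-spoke⁻ v found with v ≡ᵇ wrap n i in is-i
    ... | true  = inj₁ (≡ᵇ⇒≡ v (wrap n i) (subst T (sym is-i) tt))
    ... | false = inj₂ (≡ᵇ⇒≡ v (wrap n j) (subst T (sym found) tt))

    arc-rim⁻ : ∀ w → arc (rim w) ≡ true → Σ ℕ λ t → i ≤ t × t < j × w ≡ wrap n t
    arc-rim⁻ w found with any-range⁻ _ i (j ∸ i) found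
    ... | t , (i≤t , t<) , is-t = t , i≤t , subst (t <_) i+[j∸i]≡j t< , ≡ᵇ⇒≡ w (wrap n t) (subst T (sym is-t) tt)

    Partner : WheelEdge → ℕ → Set
    Partner y v = Σ WheelEdge λ z → Valid z × arc z ≡ true × z ≢ y × Meets z v

    partner-spoke-i : ∀ v → Meets (spoke (wrap n i)) v → Partner (spoke (wrap n i)) v
    partner-spoke-i v (inj₁ hub) =
      spoke (wrap n j) , wrap<n j j<2n , arc-spoke-j , (wrap-i≢wrap-j ∘ sym ∘ spoke-injective) , inj₁ hub
    partner-spoke-i v (inj₂ end) = rim (wrap n i) , wrap<n i i<2n , arc-rim i ≤-refl i<j , (λ ()) , inj₁ end

    partner-spoke-j : ∀ v → Meets (spoke (wrap n j)) v → Partner (spoke (wrap n j)) v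
    partner-spoke-j v (inj₁ hub) = spoke (wrap n i) , wrap<n i i<2n , arc-spoke-i , (wrap-i≢wrap-j ∘ spoke-injective) , inj₁ hub
    partner-spoke-j v (inj₂ end) =
      rim (wrap n j′) , wrap<n j′ (<-trans j′<j j<2n) , arc-rim j′ (≤-pred (subst (i <_) (sym 1+j′≡j) i<j)) j′<j ,
      (λ ()) ,
      inj₂ (trans (cong suc (trans (next-wrap j′ (subst (_< n + n) (sym 1+j′≡j) j<2n)) (cong (wrap n) 1+j′≡j))) end)
      where
      j′ = j ∸ 1
      1+j′≡j : suc j′ ≡ j
      1+j′≡j = m+[n∸m]≡n (≤-trans (s≤s z≤n) i<j)
      j′<j : j′ < j
      j′<j = subst (j′ <_) 1+j′≡j (n<1+n j′)

    partner-rim : ∀ t v → i ≤ t → t < j → Meets (rim (wrap n t)) v → Partner (rim (wrap n t)) v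
    partner-rim t v i≤t t<j (inj₁ tail-end) with i ≟ t
    ... | yes refl = spoke (wrap n i) , wrap<n i i<2n , arc-spoke-i , (λ ()) , inj₂ tail-end
    ... | no  i≢t  =
      rim (wrap n t′) , wrap<n t′ (<-trans t′<j j<2n) ,
      arc-rim t′ (≤-pred (subst (i <_) (sym 1+t′≡t) (≤∧≢⇒< i≤t i≢t))) t′<j ,
      (λ eq → wrap≢wrap-suc t′ 1+t′<2n (trans (rim-injective eq) (cong (wrap n) (sym 1+t′≡t)))) ,
      inj₂ (trans (cong suc (trans (next-wrap t′ 1+t′<2n) (cong (wrap n) 1+t′≡t))) tail-end)
      where
      t′ = t ∸ 1
      1+t′≡t : suc t′ ≡ t
      1+t′≡t = m+[n∸m]≡n (≤-trans (s≤s z≤n) (≤∧≢⇒< i≤t i≢t))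
      t′<j : t′ < j
      t′<j = <-trans (subst (t′ <_) 1+t′≡t (n<1+n t′)) t<j
      1+t′<2n : suc t′ < n + n
      1+t′<2n = subst (_< n + n) (sym 1+t′≡t) (<-trans t<j j<2n)
    partner-rim t v i≤t t<j (inj₂ head-end) with m≤n⇒m<n∨m≡n t<j
    ... | inj₂ 1+t≡j = spoke (wrap n j) , wrap<n j j<2n , arc-spoke-j , (λ ()) ,
                       inj₂ (trans (cong suc (trans (cong (wrap n) (sym 1+t≡j))
                                                    (sym (next-wrap t (subst (_< n + n) (sym 1+t≡j) j<2n)))))
                                   head-end)
    ... | inj₁ 1+t<j = rim (wrap n (suc t)) , wrap<n (suc t) 1+t<2n , arc-rim (suc t) (≤-trans i≤t (n≤1+n t)) 1+t<j ,
                       (λ eq → wrap≢wrap-suc t 1+t<2n (sym (rim-injective eq))) ,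
                       inj₁ (trans (cong suc (sym (next-wrap t 1+t<2n))) head-end)
      where
      1+t<2n : suc t < n + n
      1+t<2n = <-trans 1+t<j j<2n

    arc-sharesEnds : SharesEnds arc
    arc-sharesEnds v (spoke u) _ found meets with arc-spoke⁻ u found
    ... | inj₁ refl = partner-spoke-i v meets
    ... | inj₂ refl = partner-spoke-j v meets
    arc-sharesEnds v (rim w) _ found meets with arc-rim⁻ w found
    ... | t , i≤t , t<j , refl = partner-rim t v i≤t t<j meets

  isRim : WheelEdge → Bool
  isRim (spoke _) = false
  isRim (rim _)   = true

  rims-sharesEnds : SharesEnds isRim
  rims-sharesEnds v (spoke _) _ () _
  rims-sharesEnds v (rim w) w<n _ (inj₁ tail-end) =
    rim (prev w) , prev<n w w<n , refl , prev≢id w w<n ∘ rim-injective , inj₂ (trans (cong suc (next-prev w w<n)) tail-end)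
  rims-sharesEnds v (rim w) w<n _ (inj₂ head-end) =
    rim (next w) , next<n w , refl , next≢id w w<n ∘ rim-injective , inj₁ head-end

_∋ᵇ_ : ∀ {K} → Subset K → ℕ → Bool
[]      ∋ᵇ _     = false
(b ∷ _) ∋ᵇ zero  = b
(_ ∷ S) ∋ᵇ suc k = S ∋ᵇ k

∋ᵇ-toℕ : ∀ {K} (S : Subset K) (i : Fin K) → i ∈ S → S ∋ᵇ toℕ i ≡ true
∋ᵇ-toℕ (_ ∷ _) fzero    here        = refl
∋ᵇ-toℕ (_ ∷ S) (fsuc i) (there i∈S) = ∋ᵇ-toℕ S i i∈S

∣∣≡∑< : ∀ {K} (S : Subset K) → ∣ S ∣ ≡ ∑< K (bit ∘ (S ∋ᵇ_))
∣∣≡∑< []          = refl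
∣∣≡∑< (true ∷ S)  = cong suc (∣∣≡∑< S)
∣∣≡∑< (false ∷ S) = ∣∣≡∑< S

∣prefix∣ : ∀ K k → k ≤ K → ∣ Vec.tabulate {n = K} (λ i → toℕ i <ᵇ k) ∣ ≡ k
∣prefix∣ zero    zero    _         = refl
∣prefix∣ (suc K) zero    _         = ∣prefix∣ K zero z≤n
∣prefix∣ (suc K) (suc k) (s≤s k≤K) = cong suc (∣prefix∣ K k k≤K)

module WheelLineGraph (m : ℕ) (N : ℕ) (N≡ : N ≡ Cycle.n m + Cycle.n m) where
  open Cycle m
  open WheelEdges m

  adj : Adj N
  adj i j = shareEndℕ (edgeAt n (toℕ i)) (edgeAt n (toℕ j))

  toℕ<2n : (i : Fin N) → toℕ i < n + n
  toℕ<2n i = subst (toℕ i <_) N≡ (toℕ<n i)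

  edge : Fin N → WheelEdge
  edge i = fromIndex (toℕ i)

  edge-valid : ∀ i → Valid (edge i)
  edge-valid i = fromIndex-valid (toℕ i) (toℕ<2n i)

  vertex : (x : WheelEdge) → Valid x → Fin N
  vertex x valid = fromℕ< (subst (index x <_) (sym N≡) (index<2n x valid))

  edge-vertex : ∀ x valid → edge (vertex x valid) ≡ x
  edge-vertex x valid = trans (cong fromIndex (toℕ-fromℕ< _)) (fromIndex-index x valid)

  vertex-edge : ∀ i x valid → edge i ≡ x → i ≡ vertex x valid
  vertex-edge i x valid eq =
    toℕ-injective (trans (sym (index-fromIndex (toℕ i) (toℕ<2n i))) (trans (cong index eq) (sym (toℕ-fromℕ< _))))

  toℕ-spoke : ∀ i v → edge i ≡ spoke v → toℕ i ≡ v
  toℕ-spoke i v eq = trans (sym (index-fromIndex (toℕ i) (toℕ<2n i))) (cong index eq)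

  incident⇔meets : ∀ i v → Incident (edgeAt n (toℕ i)) v ⇔ Meets (edge i) v
  incident⇔meets i v = subst (λ k → Incident (edgeAt n k) v ⇔ Meets (edge i) v) (index-fromIndex (toℕ i) (toℕ<2n i))
                         (incident-index⇔meets (edge i) v (edge-valid i))

  adjacent⇒meet : ∀ i j → T (adj i j) → edge i ≢ edge j × Σ ℕ (λ v → Meets (edge i) v × Meets (edge j) v)
  adjacent⇒meet i j ij with shareEndℕ-sound _ _ ij
  ... | distinct , v , iv , jv =
    (λ eq → distinct (cong (edgeAt n) (trans (sym (index-fromIndex (toℕ i) (toℕ<2n i)))
                                     (trans (cong index eq) (index-fromIndex (toℕ j) (toℕ<2n j)))))) ,
    v , to (incident⇔meets i v) iv , to (incident⇔meets j v) jv

  meet⇒adjacent : ∀ i j v → edge i ≢ edge j → Meets (edge i) v → Meets (edge j) v → T (adj i j)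
  meet⇒adjacent i j v distinct iv jv = shareEndℕ-complete _ _ v
    (λ eq → distinct (cong fromIndex (edgeAt-injective (toℕ i) (toℕ j) (toℕ<2n i) (toℕ<2n j) eq)))
    (from (incident⇔meets i v) iv) (from (incident⇔meets j v) jv)

  fort-witness : ∀ F u w z → F (edge u) ≡ false → Valid z → F z ≡ true → z ≢ edge w →
                 ∀ v → Meets (edge u) v → Meets z v →
                 Σ (Fin N) λ x → F (edge x) ≡ true × x ≢ w × T (adj u x)
  fort-witness F u w z u∉F valid-z z∈F z≢w v uv zv =
    x , trans (cong F x-edge) z∈F , (λ x≡w → z≢w (trans (sym x-edge) (cong edge x≡w))) ,
    meet⇒adjacent u x v u≢x uv (subst (λ e → Meets e v) (sym x-edge) zv)
    where
    x = vertex z valid-z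
    x-edge = edge-vertex z valid-z
    u≢x : edge u ≢ edge x
    u≢x eq with () ← trans (sym u∉F) (trans (cong F (trans eq x-edge)) z∈F)

  sharesEnds⇒fort : ∀ F → SharesEnds F → IsFort N adj (F ∘ edge)
  sharesEnds⇒fort F shares u w u∉F w∈F uw with adjacent⇒meet u w uw
  ... | _ , v , uv , wv with shares v (edge w) (edge-valid w) w∈F wv
  ...   | z , valid-z , z∈F , z≢w , zv = fort-witness F u w z u∉F valid-z z∈F z≢w v uv zv

  -- The two ends of an edge outside F are met by edges of F, which differ as only that edge meets both ends.
  coversWheel⇒fort : ∀ F → CoversWheel F → IsFort N adj (F ∘ edge)
  coversWheel⇒fort F covers u w u∉F _ _ with covers _ (proj₁ (ends<n+1 (edge u) (edge-valid u)))
                                         | covers _ (proj₂ (ends<n+1 (edge u) (edge-valid u)))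
  ... | y₁ , valid-y₁ , y₁∈F , y₁a | y₂ , valid-y₂ , y₂∈F , y₂b with y₁ ≟ᵉ y₂ | y₁ ≟ᵉ edge w
  ...   | no _     | no y₁≢w  = fort-witness F u w y₁ u∉F valid-y₁ y₁∈F y₁≢w _ (inj₁ refl) y₁a
  ...   | no y₁≢y₂ | yes y₁≡w =
          fort-witness F u w y₂ u∉F valid-y₂ y₂∈F (λ eq → y₁≢y₂ (trans y₁≡w (sym eq))) _ (inj₂ refl) y₂b
  ...   | yes refl | _ with meets-two⇒≡ y₁ (edge u) valid-y₁ (edge-valid u) _ _ (ends-distinct (edge u) (edge-valid u))
                               y₁a y₂b (inj₁ refl) (inj₂ refl)
  ...     | y₁≡u with () ← trans (sym y₁∈F) (trans (cong F y₁≡u) u∉F)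

  module LowerBound (S : Subset N) (zfs : IsZeroForcingSet N adj S) where

    inS : WheelEdge → Bool
    inS x = S ∋ᵇ index x

    fort-meets-S : ∀ F → IsFort N adj (F ∘ edge) → ∀ y₀ → Valid y₀ → F y₀ ≡ true →
                   ¬ (∀ y → Valid y → F y ≡ true → inS y ≡ false)
    fort-meets-S F fort y₀ valid-y₀ y₀∈F disjoint =
      fort-never-black (F ∘ edge) fort disjoint′ (vertex y₀ valid-y₀) (zfs _)
        (trans (cong F (edge-vertex y₀ valid-y₀)) y₀∈F)
      where
      disjoint′ : ∀ i → F (edge i) ≡ true → i ∈ S → ⊥
      disjoint′ i i∈F i∈S with trans (sym (disjoint (edge i) (edge-valid i) i∈F))
                                     (trans (cong (S ∋ᵇ_) (index-fromIndex (toℕ i) (toℕ<2n i))) (∋ᵇ-toℕ S i i∈S))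
      ... | ()

    rims-hit : Count.HitsRims m (inS ∘ rim)
    rims-hit no-rim = fort-meets-S isRim (sharesEnds⇒fort isRim rims-sharesEnds) (rim 0) (s≤s z≤n) refl disjoint
      where
      disjoint : ∀ y → Valid y → isRim y ≡ true → inS y ≡ false
      disjoint (rim w) w<n _ = no-rim w w<n

    -- The complement of S reaches the hub through the missing spoke, and each cycle vertex c+1
    -- through its spoke c or one of its rims prev c and c.
    stars-hit : Count.HitsStars m (inS ∘ spoke) (inS ∘ rim)
    stars-hit z₀ z₀<n spoke-z₀ uncovered =
      fort-meets-S (not ∘ inS) (coversWheel⇒fort (not ∘ inS) covers) (spoke z₀) z₀<n (cong not spoke-z₀) disjoint
      where
      disjoint : ∀ y → Valid y → not (inS y) ≡ true → inS y ≡ false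
      disjoint y _ y∉S with inS y
      ... | false = refl
      covers : CoversWheel (not ∘ inS)
      covers zero      _ = spoke z₀ , z₀<n , cong not spoke-z₀ , inj₁ refl
      covers (suc c) c<n with inS (spoke c) in spoke-c
      ... | false = spoke c , c<n , cong not spoke-c , inj₂ refl
      ... | true with uncovered c c<n spoke-c
      ...   | inj₁ rim-prev = rim (prev c) , prev<n c c<n , cong not rim-prev , inj₂ (cong suc (next-prev c c<n))
      ...   | inj₂ rim-c    = rim c , c<n , cong not rim-c , inj₁ refl

    arcs-hit : Count.HitsArcs m (inS ∘ spoke) (inS ∘ rim)
    arcs-hit i j i<j j<i+n j<2n spoke-i spoke-j no-rim =
      fort-meets-S arc (sharesEnds⇒fort arc arc-sharesEnds) (spoke (wrap n i)) (wrap<n i (<-trans i<j j<2n)) arc-spoke-i disjoint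
      where
      open Arc i j i<j j<i+n j<2n
      disjoint : ∀ y → Valid y → arc y ≡ true → inS y ≡ false
      disjoint (spoke v) _ found with arc-spoke⁻ v found
      ... | inj₁ refl = spoke-i
      ... | inj₂ refl = spoke-j
      disjoint (rim w) _ found with arc-rim⁻ w found
      ... | t , i≤t , t<j , refl = no-rim t i≤t t<j

  ∑<-rimOffset : ∀ f → ∑< n (f ∘ rimOffset) ≡ ∑< n f
  ∑<-rimOffset f =
    begin
      f 0 + ∑< (suc (suc m)) (f ∘ rimOffset ∘ suc)
    ≡⟨ cong (f 0 +_) (∑<-suc (suc m) (f ∘ rimOffset ∘ suc)) ⟩
      f 0 + (∑< (suc m) (f ∘ rimOffset ∘ suc) + f (rimOffset (2 + m)))
    ≡⟨ cong₂ (λ x y → f 0 + (x + f y)) (∑<-cong (suc m) _ _ (λ w w<1+m → cong f (rimOffset-inner w (s≤s (s≤s w<1+m)))))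
                                       rimOffset-last ⟩
      f 0 + (∑< (suc m) (f ∘ suc ∘ suc) + f 1)
    ≡⟨ cong (f 0 +_) (+-comm _ (f 1)) ⟩
      ∑< n f
    ∎
    where open ≡-Reasoning

  ∣∣≡spokes+rims : (S : Subset N) → ∣ S ∣ ≡ ∑< n (bit ∘ (S ∋ᵇ_)) + ∑< n (λ w → bit (S ∋ᵇ (n + rimOffset w)))
  ∣∣≡spokes+rims S =
    begin
      ∣ S ∣
    ≡⟨ ∣∣≡∑< S ⟩
      ∑< N (bit ∘ (S ∋ᵇ_))
    ≡⟨ cong (λ k → ∑< k (bit ∘ (S ∋ᵇ_))) N≡ ⟩
      ∑< (n + n) (bit ∘ (S ∋ᵇ_))
    ≡⟨ ∑<-+ n n (bit ∘ (S ∋ᵇ_)) ⟩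
      ∑< n (bit ∘ (S ∋ᵇ_)) + ∑< n (λ d → bit (S ∋ᵇ (n + d)))
    ≡⟨ cong (∑< n (bit ∘ (S ∋ᵇ_)) +_) (sym (∑<-rimOffset (λ d → bit (S ∋ᵇ (n + d))))) ⟩
      ∑< n (bit ∘ (S ∋ᵇ_)) + ∑< n (λ w → bit (S ∋ᵇ (n + rimOffset w)))
    ∎
    where open ≡-Reasoning

  lower-bound : (S : Subset N) → IsZeroForcingSet N adj S → suc n ≤ ∣ S ∣
  lower-bound S zfs = subst (suc n ≤_) (sym (∣∣≡spokes+rims S)) (Count.count m _ _ rims-hit stars-hit arcs-hit)
    where open LowerBound S zfs

  -- The first n + 1 line vertices: all spokes and the rim (1,2).
  S₀ : Subset N
  S₀ = Vec.tabulate (λ i → toℕ i <ᵇ suc n)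

  ∣S₀∣ : ∣ S₀ ∣ ≡ suc n
  ∣S₀∣ = ∣prefix∣ N (suc n) (subst (suc n ≤_) (sym N≡) (m<m+n n {n} (s≤s z≤n)))

  ∈S₀ : ∀ i → toℕ i ≤ n → i ∈ S₀
  ∈S₀ i i≤n = Vecₚ.lookup⇒[]= i S₀ (trans (Vecₚ.lookup∘tabulate (λ j → toℕ j <ᵇ suc n) i) (<ᵇ-true (s≤s i≤n)))

  Black₀ : Fin N → Set
  Black₀ = Black N adj S₀

  spoke-black : ∀ i v → edge i ≡ spoke v → Black₀ i
  spoke-black i v eq = init (∈S₀ i (<⇒≤ (subst (_< n) (sym (toℕ-spoke i v eq)) (subst Valid eq (edge-valid i)))))

  rim-black : ∀ w (w<n : w < n) → Black₀ (vertex (rim w) w<n)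
  rim-black zero    w<n = init (∈S₀ _ (subst (_≤ n) (sym (toℕ-fromℕ< _)) (≤-reflexive (+-identityʳ n))))
  rim-black (suc w) w<n = force u (spoke-black u _ (edge-vertex (spoke (suc w)) w<n)) u~v others
    where
    u = vertex (spoke (suc w)) w<n
    v = vertex (rim (suc w)) w<n
    u-edge = edge-vertex (spoke (suc w)) w<n
    v-edge = edge-vertex (rim (suc w)) w<n
    u~v : T (adj u v)
    u~v = meet⇒adjacent u v (2 + w) (λ eq → spoke≢rim (trans (sym u-edge) (trans eq v-edge)))
            (subst (λ y → Meets y (2 + w)) (sym u-edge) (inj₂ refl))
            (subst (λ y → Meets y (2 + w)) (sym v-edge) (inj₁ refl))
      where
      spoke≢rim : spoke (suc w) ≢ rim (suc w)
      spoke≢rim ()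
    w<n′ : w < n
    w<n′ = <-trans (n<1+n w) w<n
    neighbour : ∀ x y → edge x ≡ y → x ≢ v → ∀ c → Meets (spoke (suc w)) c → Meets y c → Black₀ x
    neighbour x (spoke z) x-edge _ _ _ _ = spoke-black x z x-edge
    neighbour x (rim z) x-edge _ c (inj₁ refl) (inj₁ ())
    neighbour x (rim z) x-edge _ c (inj₁ refl) (inj₂ ())
    neighbour x (rim z) x-edge x≢v c (inj₂ at-u) (inj₁ at-x) =
      ⊥-elim (x≢v (vertex-edge x (rim (suc w)) w<n (trans x-edge (cong rim (suc-injective (trans at-x (sym at-u)))))))
    neighbour x (rim z) x-edge x≢v c (inj₂ at-u) (inj₂ at-x) =
      subst Black₀ (sym (vertex-edge x (rim w) w<n′ (trans x-edge (cong rim z≡w)))) (rim-black w w<n′)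
      where
      z≡w : z ≡ w
      z≡w = next≡suc⇒ z w (subst Valid x-edge (edge-valid x)) (suc-injective (trans at-x (sym at-u)))
    others : ∀ x → T (adj u x) → x ≢ v → Black₀ x
    others x u~x x≢v with adjacent⇒meet u x u~x
    ... | _ , c , uc , xc = neighbour x (edge x) refl x≢v c (subst (λ y → Meets y c) u-edge uc) xc

  S₀-zeroForcing : IsZeroForcingSet N adj S₀
  S₀-zeroForcing i with edge i in i-edge
  ... | spoke v = spoke-black i v i-edge
  ... | rim w   = subst Black₀ (sym (vertex-edge i (rim w) w<n i-edge)) (rim-black w w<n)
    where
    w<n : w < n
    w<n = subst Valid i-edge (edge-valid i)

  zeroForcingNumber : ZeroForcingNumber N adj (suc n)
  zeroForcingNumber = (S₀ , S₀-zeroForcing , ∣S₀∣) , lower-bound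

theorem3p17 : (n : ℕ) → 3 ≤ n →
    ZeroForcingNumber (lineSize (wheelSize n) (wheelAdj n))
                      (lineAdj (wheelSize n) (wheelAdj n)) (suc n)
theorem3p17 .(3 + m) (s≤s (s≤s (s≤s {n = m} _))) =
  ZeroForcingNumber-resp-≗ _ _ adj≗lineAdj (WheelLineGraph.zeroForcingNumber m (length es) length≡)
  where
  n = 3 + m
  es = edges (suc n) (wheelAdj n)
  enumerated : map endsℕ es ≡ map (edgeAt n) (range 0 (n + n))
  enumerated = map-endsℕ-edges-wheel-enumerated m
  length≡ : length es ≡ n + n
  length≡ = length-≡-range endsℕ (edgeAt n) es 0 (n + n) enumerated
  -- Defs.shareEnd compares endpoints through toℕ, so it is shareEndℕ after endsℕ by definition.
  adj≗lineAdj : ∀ i j → shareEndℕ (edgeAt n (toℕ i)) (edgeAt n (toℕ j)) ≡ lineAdj (suc n) (wheelAdj n) i j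
  adj≗lineAdj i j = sym (cong₂ shareEndℕ (lookup-≡-range endsℕ (edgeAt n) es 0 (n + n) enumerated i)
                                          (lookup-≡-range endsℕ (edgeAt n) es 0 (n + n) enumerated j))
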